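{- Let $G$ be a finite graph (not necessarily connected) with edge set $E$, and let $A\subseteq E$. Color all edges of $E\setminus A$ with a single color $\lambda$ and let $\mathcal{H}=A$ be the set of zero edges. Let $\mathcal{R}=\mathbb{Z}[z]$ and $\psi(G')=z^{r(G')}$, where $r(G')=|V(G')|-k(G')$ is the rank of a graph $G'$ ($k$ = number of connected components). Then for every proper labeling $\phi$, substituting $x_\lambda\mapsto1$, $y_\lambda\mapsto1$, $X_\lambda\mapsto x$, $Y_\lambda\mapsto y$ into the relative Tutte polynomial $T_\mathcal{H}^\psi(G,\phi)$ yields $$t(M;A;x,y,z)=\sum_{X\subseteq E\setminus A}(x-1)^{r(M)-r_M(X\cup A)}(y-1)^{|X|-r_M(X)}z^{r_M(X\cup A)-r_M(X)},$$ where $M$ is the cycle matroid of $G$ with rank function $r_M$ and rank $r(M)$.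
   Context: Graphs may have loops and multiple edges. A cycle is the edge set of a circuit (a loop is a cycle); a cocycle is a minimal set of edges whose removal increases the number of connected components. A contracting set with respect to $\mathcal{H}$ is $\mathcal{C}\subseteq E\setminus\mathcal{H}$ containing no cycle such that $\mathcal{D}=E\setminus(\mathcal{C}\cup\mathcal{H})$ contains no cocycle; $\mathcal{H}_\mathcal{C}$ is $G$ with $\mathcal{D}$ deleted and $\mathcal{C}$ contracted. A proper labeling $\phi:E\to\mathbb{Z}$ is $0$ on $\mathcal{H}$ and injective into positive integers on $E\setminus\mathcal{H}$. For $e\in\mathcal{C}$: internally active if $\mathcal{D}\cup\{e\}$ contains a cocycle in which $e$ has the smallest label, else internally inactive; for $f\in\mathcal{D}$: externally active if $\mathcal{C}\cup\{f\}$ contains a cycle in which $f$ has the smallest label, else externally inactive. Weights: $X_\lambda$, $x_\lambda$, $Y_\lambda$, $y_\lambda$ for internally active, internally inactive, externally active, externally inactive respectively. $T_\mathcal{H}^\psi(G,\phi)=\sum_\mathcal{C}\big(\prod_{e\in E\setminus\mathcal{H}}w(e)\big)\psi(\mathcal{H}_\mathcal{C})\in\mathbb{Z}[z][X_\lambda,Y_\lambda,x_\lambda,y_\lambda]$, summed over all contracting sets. -}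

module Defs where

open import Level using (Level)
open import Data.Bool using (Bool; true; false; _∧_; _∨_; not; if_then_else_)
open import Data.Nat as ℕ using (ℕ; zero; suc; _∸_) renaming (_≤ᵇ_ to _≤ℕ_; _<ᵇ_ to _<ℕ_)
open import Data.Integer as ℤ using (ℤ; _≤ᵇ_; 0ℤ; _<_)
open import Data.Fin using (Fin; toℕ)
open import Data.Bool.Properties using () renaming (_≟_ to _≟ᵇ_)
open import Data.Fin.Subset using (Subset; ⁅_⁆; _∪_; _∩_; ∁; _─_; ∣_∣; _∈_; _∉_)
open import Data.Vec using (Vec; []; _∷_; lookup; tabulate; allFin; toList)
open import Data.List as List using (List; []; _∷_; _++_)
open import Data.Product using (_×_; _,_; proj₁; proj₂)
open import Relation.Nullary using (does)
open import Relation.Binary.PropositionalEquality using (_≡_)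
open import Algebra.Bundles using (CommutativeRing)

record Graph : Set where
  field
    n    : ℕ
    m    : ℕ
    ends : Fin m → Fin n × Fin n

all : ∀ {a} {A : Set a} → (A → Bool) → List A → Bool
all p = List.foldr (λ a b → p a ∧ b) true

any : ∀ {a} {A : Set a} → (A → Bool) → List A → Bool
any p = List.foldr (λ a b → p a ∨ b) false

filterᵇ : ∀ {a} {A : Set a} → (A → Bool) → List A → List A
filterᵇ p []       = []
filterᵇ p (a ∷ as) = if p a then a ∷ filterᵇ p as else filterᵇ p as

allSubsets : (k : ℕ) → List (Subset k)
allSubsets zero    = [] ∷ []
allSubsets (suc k) = List.map (false ∷_) (allSubsets k)
                  ++ List.map (true ∷_) (allSubsets k)

mem : ∀ {k} → Fin k → Subset k → Bool
mem i S = lookup S i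

subsetᵇ : ∀ {k} → Subset k → Subset k → Bool
subsetᵇ S T = all (λ i → not (mem i S) ∨ mem i T) (toList (allFin _))

eqSetᵇ : ∀ {k} → Subset k → Subset k → Bool
eqSetᵇ S T = subsetᵇ S T ∧ subsetᵇ T S

subsetsOf : ∀ {k} → Subset k → List (Subset k)
subsetsOf {k} S = filterᵇ (λ T → subsetᵇ T S) (allSubsets k)

minimalᵇ : ∀ {k} → (Subset k → Bool) → Subset k → Bool
minimalᵇ P S = P S ∧ all (λ T → eqSetᵇ T S ∨ not (P T)) (subsetsOf S)

module _ (G : Graph) where
  open Graph G

  step : Subset m → Subset n → Subset n
  step X S = List.foldr add S (toList (allFin m))
    where
    add : Fin m → Subset n → Subset n
    add e T with ends e
    ... | (a , b) =
      if mem e X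
        then (if mem a T then T ∪ ⁅ b ⁆ else T) ∪ (if mem b T then ⁅ a ⁆ else T)
        else T

  iter : ℕ → Subset m → Subset n → Subset n
  iter zero    X S = S
  iter (suc i) X S = step X (iter i X S)

  -- vertices reachable from v using edges of X (n rounds suffice)
  reach : Subset m → Fin n → Subset n
  reach X v = iter n X ⁅ v ⁆

  isRep : Subset m → Fin n → Bool
  isRep X v = all (λ u → not (mem u (reach X v)) ∨ (toℕ v ≤ℕ toℕ u))
                  (toList (allFin n))

  components : Subset m → ℕ
  components X = ∣ tabulate (isRep X) ∣

  rank : Subset m → ℕ
  rank X = n ∸ components X

  E : Subset m
  E = tabulate (λ _ → true)

  rankM : ℕ
  rankM = rank E

  isCycle : Subset m → Bool
  isCycle = minimalᵇ (λ S → _<ℕ_ (rank S) ∣ S ∣)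

  isCocycle : Subset m → Bool
  isCocycle = minimalᵇ (λ S → _<ℕ_ (components E) (components (E ─ S)))

  containsCycle : Subset m → Bool
  containsCycle X = any isCycle (subsetsOf X)

  containsCocycle : Subset m → Bool
  containsCocycle X = any isCocycle (subsetsOf X)

  ProperLabeling : Subset m → (Fin m → ℤ) → Set
  ProperLabeling H φ =
      (∀ e → e ∈ H → φ e ≡ 0ℤ)
    × (∀ e → e ∉ H → 0ℤ < φ e)
    × (∀ e f → e ∉ H → f ∉ H → φ e ≡ φ f → e ≡ f)

  compl : Subset m → Subset m → Subset m
  compl H C = ∁ (C ∪ H)

  isContracting : Subset m → Subset m → Bool
  isContracting H C =
    subsetᵇ C (∁ H) ∧ not (containsCycle C) ∧ not (containsCocycle (compl H C))

  smallestIn : (Fin m → ℤ) → Fin m → Subset m → Bool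
  smallestIn φ e S = all (λ g → not (mem g S) ∨ (φ e ≤ᵇ φ g)) (toList (allFin m))

  internallyActive : Subset m → (Fin m → ℤ) → Subset m → Fin m → Bool
  internallyActive H φ C e =
    any (λ S → isCocycle S ∧ mem e S ∧ smallestIn φ e S)
        (subsetsOf (compl H C ∪ ⁅ e ⁆))

  externallyActive : Subset m → (Fin m → ℤ) → Subset m → Fin m → Bool
  externallyActive H φ C f =
    any (λ S → isCycle S ∧ mem f S ∧ smallestIn φ f S)
        (subsetsOf (C ∪ ⁅ f ⁆))

  -- rank r(H_C) = |V(H_C)| - k(H_C) of the graph H_C (D deleted, C contracted):
  -- the vertices of H_C are the components of (V, C), and the components of
  -- H_C correspond to the components of (V, C ∪ H).
  rankContracted : Subset m → Subset m → ℕ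
  rankContracted H C = components C ∸ components (C ∪ H)

module _ {c ℓ : Level} (R : CommutativeRing c ℓ) where
  open CommutativeRing R

  pow : Carrier → ℕ → Carrier
  pow a zero    = 1#
  pow a (suc k) = a * pow a k

  sumL : List Carrier → Carrier
  sumL = List.foldr _+_ 0#

  prodL : List Carrier → Carrier
  prodL = List.foldr _*_ 1#

  -- Relative Tutte polynomial T_H^ψ(G, φ) (one colour λ, ψ(G') = z^{r(G')}),
  -- evaluated at X_λ = Xa, x_λ = xi, Y_λ = Ya, y_λ = ye, z = zz.
  relTutte : (G : Graph) → Subset (Graph.m G) → (Fin (Graph.m G) → ℤ)
           → (Xa xi Ya ye zz : Carrier) → Carrier
  relTutte G H φ Xa xi Ya ye zz =
    sumL (List.map term (filterᵇ (λ C → isContracting G H C)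
                                (allSubsets (Graph.m G))))
    where
    term : Subset (Graph.m G) → Carrier
    term C = prodL (List.map w (toList (allFin (Graph.m G)))) * pow zz (rankContracted G H C)
      where
      w : Fin (Graph.m G) → Carrier
      w e = if mem e H then 1#
            else if mem e C
              then (if internallyActive G H φ C e then Xa else xi)
              else (if externallyActive G H φ C e then Ya else ye)

  tPoly : (G : Graph) → Subset (Graph.m G) → (x y zz : Carrier) → Carrier
  tPoly G A x y zz =
    sumL (List.map term (subsetsOf (∁ A)))
    where
    term : Subset (Graph.m G) → Carrier
    term X = pow (x - 1#) (rankM G ∸ rank G (X ∪ A))
           * pow (y - 1#) (∣ X ∣ ∸ rank G X)
           * pow zz (rank G (X ∪ A) ∸ rank G X)

module Submission where

-- Write x = (x − 1) + 1 and y = 1 + (y − 1) and expand the product of the edge weights of a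
-- contracting set C. A term of the expansion is recorded by the set X of edges taking the factor 1
-- inside C or the factor y − 1 outside C; it vanishes unless X ⊆ E ─ A, every edge of C ─ X is
-- internally active and every edge of X ─ C externally active (C is compatible with X). Read through
-- the rank function, e ∈ C is internally active iff (C − e) ∪ A together with the edges labelled
-- below e does not span, and f ∉ C ∪ A is externally active iff the edges of C labelled above f span f.
-- Exchanging the two sums, it remains to see that each X ⊆ E ─ A has exactly one compatible
-- contracting set C — going down through the labels, X and the part of C above an edge force whether
-- the edge lies in C — and that r(X) = ∣ C ∩ X ∣ and r(X ∪ A) + ∣ C ─ X ∣ = r(E), since the edges of
-- C ─ X are coloops of X ∪ C and of X ∪ A ∪ C while those of X ─ C are spanned by C.

open import Level using (Level)
open import Algebra.Bundles using (CommutativeRing)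
open import Defs using (Graph; ProperLabeling; relTutte; tPoly; isContracting; filterᵇ; allSubsets; subsetᵇ; subsetsOf)
open import Data.Bool using (true; false; if_then_else_)
open import Data.Nat using (ℕ; suc)
open import Data.Integer using (ℤ)
open import Data.Fin using (Fin)
open import Data.Fin.Subset using (Subset; ⁅_⁆; _∪_; ∁; ⊥)
open import Data.Sum using (_⊎_)
open import Relation.Binary.PropositionalEquality using (_≡_)

module BooleanSubsets where
  open import Defs using (all; any; filterᵇ; allSubsets; subsetᵇ; eqSetᵇ; subsetsOf; minimalᵇ)
  open import Data.Bool using (Bool; true; false; _∧_; _∨_; not; T)
  open import Data.Bool.Properties using (∧-zeroʳ; ∧-identityʳ; ∨-identityʳ; ∧-comm)
  open import Data.Nat as ℕ using (ℕ; zero; suc; _+_; _≤_; _<_; z≤n; s≤s)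
  open import Data.Nat.Properties as ℕ
    using (≤-refl; ≤-trans; n≤1+n; +-suc; m≤m⊔n; m≤n⊔m)
  open import Data.Nat.Induction using (<-wellFounded)
  open import Induction.WellFounded using (Acc; acc)
  open import Data.Fin using (Fin; zero; suc)
  open import Data.Fin.Properties using (suc-injective) renaming (_≟_ to _≟F_)
  open import Data.Fin.Subset using (Subset; ⁅_⁆; _∪_; _∩_; ∁; _─_; _-_; ∣_∣; ⊥)
  open import Data.Vec using ([]; _∷_; lookup; tabulate; toList; allFin)
  open import Data.Vec.Properties
    using (lookup-zipWith; lookup-map; lookup∘tabulate; tabulate∘lookup; tabulate-cong; lookup-replicate)
  open import Data.List using ([]; _∷_; map)
  open import Data.List.Relation.Unary.Any using (here; there)
  open import Data.List.Membership.Propositional using () renaming (_∈_ to _∈ˡ_)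
  open import Data.List.Membership.Propositional.Properties using (∈-++⁺ˡ; ∈-++⁺ʳ; ∈-map⁺)
  open import Data.Product using (Σ; _×_; _,_; proj₁; proj₂)
  open import Data.Sum using (_⊎_; inj₁; inj₂; [_,_]′)
  open import Data.Empty using (⊥-elim)
  open import Relation.Nullary using (¬_; yes; no)
  open import Relation.Binary.PropositionalEquality hiding ([_])

  true≢false : true ≢ false
  true≢false ()

  ≢true⇒≡false : ∀ {b} → b ≢ true → b ≡ false
  ≢true⇒≡false {false} _ = refl
  ≢true⇒≡false {true}  p = ⊥-elim (p refl)

  ≢false⇒≡true : ∀ {b} → b ≢ false → b ≡ true
  ≢false⇒≡true {true}  _ = refl
  ≢false⇒≡true {false} p = ⊥-elim (p refl)

  true⊎false : ∀ b → b ≡ true ⊎ b ≡ false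
  true⊎false true  = inj₁ refl
  true⊎false false = inj₂ refl

  ≡-by-⇔ : ∀ {b c} → (b ≡ true → c ≡ true) → (c ≡ true → b ≡ true) → b ≡ c
  ≡-by-⇔ {true}  {true}  f g = refl
  ≡-by-⇔ {true}  {false} f g = sym (f refl)
  ≡-by-⇔ {false} {true}  f g = g refl
  ≡-by-⇔ {false} {false} f g = refl

  ∨-elim : ∀ {a b} → a ∨ b ≡ true → a ≡ true ⊎ b ≡ true
  ∨-elim {true}  p = inj₁ refl
  ∨-elim {false} p = inj₂ p

  ∨-introˡ : ∀ {a b} → a ≡ true → a ∨ b ≡ true
  ∨-introˡ refl = refl

  ∨-introʳ : ∀ {a b} → b ≡ true → a ∨ b ≡ true
  ∨-introʳ {true}  p = refl
  ∨-introʳ {false} p = p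

  ∧-elim : ∀ {a b} → a ∧ b ≡ true → a ≡ true × b ≡ true
  ∧-elim {true} {true} p = refl , refl

  ∧-intro : ∀ {a b} → a ≡ true → b ≡ true → a ∧ b ≡ true
  ∧-intro refl refl = refl

  not-intro : ∀ {a} → a ≡ false → not a ≡ true
  not-intro refl = refl

  not-elim : ∀ {a} → not a ≡ true → a ≡ false
  not-elim {false} p = refl

  T⇒≡true : ∀ {b} → T b → b ≡ true
  T⇒≡true {true} _ = refl

  ≡true⇒T : ∀ {b} → b ≡ true → T b
  ≡true⇒T refl = _

  <ᵇ-sound : ∀ {a b} → (a ℕ.<ᵇ b) ≡ true → a < b
  <ᵇ-sound p = ℕ.<ᵇ⇒< _ _ (≡true⇒T p)

  <ᵇ-complete : ∀ {a b} → a < b → (a ℕ.<ᵇ b) ≡ true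
  <ᵇ-complete p = T⇒≡true (ℕ.<⇒<ᵇ p)

  <ᵇ-false : ∀ {a b} → (a ℕ.<ᵇ b) ≡ false → ¬ (a < b)
  <ᵇ-false p q = true≢false (trans (sym (<ᵇ-complete q)) p)

  ≡ᵇ-sound : ∀ {a b} → (a ℕ.≡ᵇ b) ≡ true → a ≡ b
  ≡ᵇ-sound p = ℕ.≡ᵇ⇒≡ _ _ (≡true⇒T p)

  ≡ᵇ-complete : ∀ {a b} → a ≡ b → (a ℕ.≡ᵇ b) ≡ true
  ≡ᵇ-complete p = T⇒≡true (ℕ.≡⇒≡ᵇ _ _ p)

  ≤ᵇ-sound : ∀ {a b} → (a ℕ.≤ᵇ b) ≡ true → a ≤ b
  ≤ᵇ-sound p = ℕ.≤ᵇ⇒≤ _ _ (≡true⇒T p)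

  ≤ᵇ-complete : ∀ {a b} → a ≤ b → (a ℕ.≤ᵇ b) ≡ true
  ≤ᵇ-complete p = T⇒≡true (ℕ.≤⇒≤ᵇ p)

  bounded : ∀ {k} (f : Fin k → ℕ) → Σ ℕ λ B → ∀ g → f g < B
  bounded {zero}  f = 0 , λ ()
  bounded {suc k} f with bounded (λ g → f (suc g))
  ... | B , h = suc (f zero) ℕ.⊔ B
              , λ { zero → m≤m⊔n (suc (f zero)) B ; (suc g) → ≤-trans (h g) (m≤n⊔m (suc (f zero)) B) }

  infixl 9 _!_
  _!_ : ∀ {m} → Subset m → Fin m → Bool
  S ! i = lookup S i

  infix 4 _⊆_
  -- Stated on Boolean entries, the form in which Defs computes, rather than through `Data.Fin.Subset._∈_`.
  record _⊆_ {m} (S T : Subset m) : Set where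
    constructor sub
    field app : ∀ i → S ! i ≡ true → T ! i ≡ true
  open _⊆_ public

  ⊆-refl : ∀ {m} {S : Subset m} → S ⊆ S
  ⊆-refl = sub λ _ q → q

  ⊆-trans : ∀ {m} {S T U : Subset m} → S ⊆ T → T ⊆ U → S ⊆ U
  ⊆-trans p q = sub λ i h → app q i (app p i h)

  ext : ∀ {m} {S T : Subset m} → (∀ i → S ! i ≡ T ! i) → S ≡ T
  ext {S = S} {T} p = trans (sym (tabulate∘lookup S)) (trans (tabulate-cong p) (tabulate∘lookup T))

  ⊆-antisym : ∀ {m} {S T : Subset m} → S ⊆ T → T ⊆ S → S ≡ T
  ⊆-antisym {S = S} {T} p q = ext λ i → ≡-by-⇔ (app p i) (app q i)

  !tabulate : ∀ {m} (f : Fin m → Bool) i → tabulate f ! i ≡ f i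
  !tabulate f i = lookup∘tabulate f i

  !⊥ : ∀ {m} (i : Fin m) → (⊥ {m}) ! i ≡ false
  !⊥ i = lookup-replicate i false

  ⊥⊆ : ∀ {m} {S : Subset m} → ⊥ ⊆ S
  ⊥⊆ = sub λ i q → ⊥-elim (true≢false (trans (sym q) (!⊥ i)))

  !∪ : ∀ {m} (S T : Subset m) i → (S ∪ T) ! i ≡ (S ! i ∨ T ! i)
  !∪ S T i = lookup-zipWith _∨_ i S T

  !∩ : ∀ {m} (S T : Subset m) i → (S ∩ T) ! i ≡ (S ! i ∧ T ! i)
  !∩ S T i = lookup-zipWith _∧_ i S T

  !∁ : ∀ {m} (S : Subset m) i → (∁ S) ! i ≡ not (S ! i)
  !∁ S i = lookup-map i not S

  !─ : ∀ {m} (S T : Subset m) i → (S ─ T) ! i ≡ (S ! i ∧ not (T ! i))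
  !─ (x ∷ S) (true  ∷ T) zero    = sym (∧-zeroʳ x)
  !─ (x ∷ S) (false ∷ T) zero    = sym (∧-identityʳ x)
  !─ (x ∷ S) (y     ∷ T) (suc i) = !─ S T i

  !⁅⁆-same : ∀ {m} (i : Fin m) → ⁅ i ⁆ ! i ≡ true
  !⁅⁆-same zero    = refl
  !⁅⁆-same (suc i) = !⁅⁆-same i

  !⁅⁆⇒≡ : ∀ {m} (j i : Fin m) → ⁅ j ⁆ ! i ≡ true → j ≡ i
  !⁅⁆⇒≡ zero    zero    p = refl
  !⁅⁆⇒≡ zero    (suc i) p = ⊥-elim (true≢false (trans (sym p) (!⊥ i)))
  !⁅⁆⇒≡ (suc j) zero    ()
  !⁅⁆⇒≡ (suc j) (suc i) p = cong suc (!⁅⁆⇒≡ j i p)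

  !⁅⁆-other : ∀ {m} (j i : Fin m) → j ≢ i → ⁅ j ⁆ ! i ≡ false
  !⁅⁆-other j i ne = ≢true⇒≡false λ q → ne (!⁅⁆⇒≡ j i q)

  ∪l : ∀ {m} (S T : Subset m) {i} → S ! i ≡ true → (S ∪ T) ! i ≡ true
  ∪l S T {i} p = trans (!∪ S T i) (∨-introˡ p)

  ∪r : ∀ {m} (S T : Subset m) {i} → T ! i ≡ true → (S ∪ T) ! i ≡ true
  ∪r S T {i} p = trans (!∪ S T i) (∨-introʳ p)

  ∪e : ∀ {m} (S T : Subset m) {i} → (S ∪ T) ! i ≡ true → S ! i ≡ true ⊎ T ! i ≡ true
  ∪e S T {i} p = ∨-elim (trans (sym (!∪ S T i)) p)

  ∩i : ∀ {m} (S T : Subset m) {i} → S ! i ≡ true → T ! i ≡ true → (S ∩ T) ! i ≡ true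
  ∩i S T {i} p q = trans (!∩ S T i) (∧-intro p q)

  ∩e : ∀ {m} (S T : Subset m) {i} → (S ∩ T) ! i ≡ true → S ! i ≡ true × T ! i ≡ true
  ∩e S T {i} p = ∧-elim (trans (sym (!∩ S T i)) p)

  ─i : ∀ {m} (S T : Subset m) {i} → S ! i ≡ true → T ! i ≡ false → (S ─ T) ! i ≡ true
  ─i S T {i} p q = trans (!─ S T i) (∧-intro p (not-intro q))

  ─e : ∀ {m} (S T : Subset m) {i} → (S ─ T) ! i ≡ true → S ! i ≡ true × T ! i ≡ false
  ─e S T {i} p with ∧-elim (trans (sym (!─ S T i)) p)
  ... | a , b = a , not-elim b

  ∁i : ∀ {m} (S : Subset m) {i} → S ! i ≡ false → (∁ S) ! i ≡ true
  ∁i S {i} p = trans (!∁ S i) (not-intro p)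

  ∁e : ∀ {m} (S : Subset m) {i} → (∁ S) ! i ≡ true → S ! i ≡ false
  ∁e S {i} p = not-elim (trans (sym (!∁ S i)) p)

  ⊆∪l : ∀ {m} (S T : Subset m) → S ⊆ S ∪ T
  ⊆∪l S T = sub λ i h → ∪l S T h

  ⊆∪r : ∀ {m} (S T : Subset m) → T ⊆ S ∪ T
  ⊆∪r S T = sub λ i h → ∪r S T h

  ∪⊆ : ∀ {m} {S T U : Subset m} → S ⊆ U → T ⊆ U → S ∪ T ⊆ U
  ∪⊆ {S = S} {T} p q = sub λ i h → [ app p i , app q i ]′ (∪e S T h)

  ∩⊆l : ∀ {m} (S T : Subset m) → S ∩ T ⊆ S
  ∩⊆l S T = sub λ i q → proj₁ (∩e S T q)

  ─⊆ : ∀ {m} (S T : Subset m) → S ─ T ⊆ S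
  ─⊆ S T = sub λ i q → proj₁ (─e S T q)

  ∪-⊆-absorb : ∀ {m} {S T : Subset m} → S ⊆ T → S ∪ T ≡ T
  ∪-⊆-absorb {S = S} {T} h = ⊆-antisym (∪⊆ h ⊆-refl) (⊆∪r S T)

  ∪⊥ : ∀ {m} (S : Subset m) → S ∪ ⊥ ≡ S
  ∪⊥ S = ⊆-antisym (∪⊆ ⊆-refl ⊥⊆) (⊆∪l S ⊥)

  ⊥∪ : ∀ {m} (S : Subset m) → ⊥ ∪ S ≡ S
  ⊥∪ S = ∪-⊆-absorb ⊥⊆

  ∪-assoc-⁅⁆ : ∀ {m} (S T : Subset m) e → S ∪ (T ∪ ⁅ e ⁆) ≡ (S ∪ T) ∪ ⁅ e ⁆
  ∪-assoc-⁅⁆ S T e =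
    ⊆-antisym (∪⊆ (⊆-trans (⊆∪l S T) (⊆∪l _ ⁅ e ⁆)) (∪⊆ (⊆-trans (⊆∪r S T) (⊆∪l _ ⁅ e ⁆)) (⊆∪r _ ⁅ e ⁆)))
              (∪⊆ (∪⊆ (⊆∪l S _) (⊆-trans (⊆∪l T ⁅ e ⁆) (⊆∪r S _))) (⊆-trans (⊆∪r T ⁅ e ⁆) (⊆∪r S _)))

  ∪⁅⁆-elim : ∀ {m} (S : Subset m) e i → (S ∪ ⁅ e ⁆) ! i ≡ true → S ! i ≡ true ⊎ e ≡ i
  ∪⁅⁆-elim S e i p with ∪e S ⁅ e ⁆ p
  ... | inj₁ q = inj₁ q
  ... | inj₂ q = inj₂ (!⁅⁆⇒≡ e i q)

  ∪⁅⁆-new : ∀ {m} (S : Subset m) e → (S ∪ ⁅ e ⁆) ! e ≡ true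
  ∪⁅⁆-new S e = ∪r S ⁅ e ⁆ (!⁅⁆-same e)

  ∪⁅⁆-other : ∀ {m} (S : Subset m) e i → e ≢ i → (S ∪ ⁅ e ⁆) ! i ≡ S ! i
  ∪⁅⁆-other S e i ne = trans (!∪ S ⁅ e ⁆ i) (trans (cong (S ! i ∨_) (!⁅⁆-other e i ne)) (∨-identityʳ _))

  ∪⁅⁆⊆ : ∀ {m} {S T : Subset m} e → S ⊆ T → T ! e ≡ true → S ∪ ⁅ e ⁆ ⊆ T
  ∪⁅⁆⊆ {S = S} {T} e st te = sub f
    where
    f : ∀ i → (S ∪ ⁅ e ⁆) ! i ≡ true → T ! i ≡ true
    f i q with ∪⁅⁆-elim S e i q
    ... | inj₁ a    = app st i a
    ... | inj₂ refl = te

  ∪⁅⁆-absorb : ∀ {m} (S : Subset m) e → S ! e ≡ true → S ∪ ⁅ e ⁆ ≡ S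
  ∪⁅⁆-absorb S e p = ⊆-antisym (∪⁅⁆⊆ e ⊆-refl p) (⊆∪l S ⁅ e ⁆)

  -self : ∀ {m} (S : Subset m) e → (S - e) ! e ≡ false
  -self S e = trans (!─ S ⁅ e ⁆ e) (trans (cong (λ b → S ! e ∧ not b) (!⁅⁆-same e)) (∧-zeroʳ _))

  -other : ∀ {m} (S : Subset m) e i → e ≢ i → (S - e) ! i ≡ S ! i
  -other S e i ne = trans (!─ S ⁅ e ⁆ i) (trans (cong (λ b → S ! i ∧ not b) (!⁅⁆-other e i ne)) (∧-identityʳ _))

  -intro : ∀ {m} (S : Subset m) {e i} → S ! i ≡ true → e ≢ i → (S - e) ! i ≡ true
  -intro S {e} {i} p ne = trans (-other S e i ne) p

  -elim : ∀ {m} (S : Subset m) {e i} → (S - e) ! i ≡ true → S ! i ≡ true × e ≢ i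
  -elim S {e} {i} p with ─e S ⁅ e ⁆ p
  ... | a , b = a , λ { refl → true≢false (trans (sym (!⁅⁆-same i)) b) }

  -⊆ : ∀ {m} (S : Subset m) e → S - e ⊆ S
  -⊆ S e = ─⊆ S ⁅ e ⁆

  -∪⁅⁆ : ∀ {m} (S : Subset m) e → S ! e ≡ true → (S - e) ∪ ⁅ e ⁆ ≡ S
  -∪⁅⁆ S e p = ext lem
    where
    lem : ∀ i → ((S - e) ∪ ⁅ e ⁆) ! i ≡ S ! i
    lem i with e ≟F i
    ... | yes refl = trans (∪⁅⁆-new (S - e) e) (sym p)
    ... | no ne    = trans (∪⁅⁆-other (S - e) e i ne) (-other S e i ne)

  ─∪⁅⁆ : ∀ {m} (Q R : Subset m) e → Q ─ (R ∪ ⁅ e ⁆) ≡ (Q ─ R) - e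
  ─∪⁅⁆ Q R e = ext λ i → begin
    (Q ─ (R ∪ ⁅ e ⁆)) ! i                   ≡⟨ !─ Q _ i ⟩
    Q ! i ∧ not ((R ∪ ⁅ e ⁆) ! i)           ≡⟨ cong (λ b → Q ! i ∧ not b) (!∪ R ⁅ e ⁆ i) ⟩
    Q ! i ∧ not (R ! i ∨ ⁅ e ⁆ ! i)         ≡⟨ split (Q ! i) (R ! i) (⁅ e ⁆ ! i) ⟩
    (Q ! i ∧ not (R ! i)) ∧ not (⁅ e ⁆ ! i) ≡⟨ cong (_∧ not (⁅ e ⁆ ! i)) (sym (!─ Q R i)) ⟩
    (Q ─ R) ! i ∧ not (⁅ e ⁆ ! i)           ≡⟨ sym (!─ (Q ─ R) ⁅ e ⁆ i) ⟩
    ((Q ─ R) - e) ! i                       ∎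
    where
    open ≡-Reasoning
    split : ∀ a b c → a ∧ not (b ∨ c) ≡ (a ∧ not b) ∧ not c
    split false b     c = refl
    split true  true  c = refl
    split true  false c = refl

  ∪-─ : ∀ {m} (S C : Subset m) → S ⊆ C → S ∪ (C ─ S) ≡ C
  ∪-─ S C h = ⊆-antisym (∪⊆ h (─⊆ C S)) (sub f)
    where
    f : ∀ i → C ! i ≡ true → (S ∪ (C ─ S)) ! i ≡ true
    f i q with true⊎false (S ! i)
    ... | inj₁ s = ∪l S _ s
    ... | inj₂ s = ∪r S _ (─i C S q s)

  ─⊥ : ∀ {m} (S : Subset m) → S ─ ⊥ ≡ S
  ─⊥ S = ⊆-antisym (─⊆ S ⊥) (sub λ i q → ─i S ⊥ q (!⊥ i))

  ∪── : ∀ {m} (Y C : Subset m) → (Y ∪ C) ─ (C ─ Y) ≡ Y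
  ∪── Y C = ext λ i → begin
    ((Y ∪ C) ─ (C ─ Y)) ! i                   ≡⟨ !─ (Y ∪ C) (C ─ Y) i ⟩
    (Y ∪ C) ! i ∧ not ((C ─ Y) ! i)           ≡⟨ cong₂ (λ a b → a ∧ not b) (!∪ Y C i) (!─ C Y i) ⟩
    (Y ! i ∨ C ! i) ∧ not (C ! i ∧ not (Y ! i)) ≡⟨ absorb (Y ! i) (C ! i) ⟩
    Y ! i                                     ∎
    where
    open ≡-Reasoning
    absorb : ∀ y c → (y ∨ c) ∧ not (c ∧ not y) ≡ y
    absorb true  c     = cong not (∧-zeroʳ c)
    absorb false true  = refl
    absorb false false = refl

  agree-on-tail : ∀ {m} {b c} {S T : Subset m} {e}
                → (∀ i → i ≢ suc e → (b ∷ S) ! i ≡ (c ∷ T) ! i) → ∀ i → i ≢ e → S ! i ≡ T ! i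
  agree-on-tail h i ne = h (suc i) λ eq → ne (suc-injective eq)

  ∣∣-one-more : ∀ {m} (S T : Subset m) e → S ! e ≡ false → T ! e ≡ true
              → (∀ i → i ≢ e → S ! i ≡ T ! i) → ∣ T ∣ ≡ suc ∣ S ∣
  ∣∣-one-more (false ∷ S) (true ∷ T) zero refl refl h =
    cong suc (cong ∣_∣ (sym (ext {S = S} {T} λ i → h (suc i) λ ())))
  ∣∣-one-more (false ∷ S) (false ∷ T) (suc e) p q h = ∣∣-one-more S T e p q (agree-on-tail h)
  ∣∣-one-more (true  ∷ S) (true  ∷ T) (suc e) p q h = cong suc (∣∣-one-more S T e p q (agree-on-tail h))
  ∣∣-one-more (false ∷ S) (true  ∷ T) (suc e) p q h = ⊥-elim (true≢false (sym (h zero λ ())))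
  ∣∣-one-more (true  ∷ S) (false ∷ T) (suc e) p q h = ⊥-elim (true≢false (h zero λ ()))

  ∣∪⁅⁆∣ : ∀ {m} (S : Subset m) e → S ! e ≡ false → ∣ S ∪ ⁅ e ⁆ ∣ ≡ suc ∣ S ∣
  ∣∪⁅⁆∣ S e p = ∣∣-one-more S (S ∪ ⁅ e ⁆) e p (∪⁅⁆-new S e) λ i ne → sym (∪⁅⁆-other S e i λ q → ne (sym q))

  ∣-∣ : ∀ {m} (S : Subset m) e → S ! e ≡ true → ∣ S ∣ ≡ suc ∣ S - e ∣
  ∣-∣ S e p = ∣∣-one-more (S - e) S e (-self S e) p λ i ne → -other S e i λ q → ne (sym q)

  ⊆⇒∣∣≤ : ∀ {m} (S T : Subset m) → S ⊆ T → ∣ S ∣ ≤ ∣ T ∣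
  ⊆⇒∣∣≤ []          []          h = z≤n
  ⊆⇒∣∣≤ (false ∷ S) (false ∷ T) h = ⊆⇒∣∣≤ S T (sub λ i → app h (suc i))
  ⊆⇒∣∣≤ (false ∷ S) (true  ∷ T) h = ≤-trans (⊆⇒∣∣≤ S T (sub λ i → app h (suc i))) (n≤1+n _)
  ⊆⇒∣∣≤ (true  ∷ S) (false ∷ T) h with app h zero refl
  ... | ()
  ⊆⇒∣∣≤ (true  ∷ S) (true  ∷ T) h = s≤s (⊆⇒∣∣≤ S T (sub λ i → app h (suc i)))

  ⊂⇒∣∣< : ∀ {m} (S T : Subset m) → S ⊆ T → S ≢ T → ∣ S ∣ < ∣ T ∣
  ⊂⇒∣∣< []          []          h ne = ⊥-elim (ne refl)
  ⊂⇒∣∣< (false ∷ S) (false ∷ T) h ne = ⊂⇒∣∣< S T (sub λ i → app h (suc i)) λ eq → ne (cong (false ∷_) eq)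
  ⊂⇒∣∣< (false ∷ S) (true  ∷ T) h ne = s≤s (⊆⇒∣∣≤ S T (sub λ i → app h (suc i)))
  ⊂⇒∣∣< (true  ∷ S) (false ∷ T) h ne with app h zero refl
  ... | ()
  ⊂⇒∣∣< (true  ∷ S) (true  ∷ T) h ne = s≤s (⊂⇒∣∣< S T (sub λ i → app h (suc i)) λ eq → ne (cong (true ∷_) eq))

  ∣∣-partition : ∀ {m} (C X : Subset m) → ∣ C ∣ ≡ ∣ C ∩ X ∣ + ∣ C ─ X ∣
  ∣∣-partition []          []          = refl
  ∣∣-partition (false ∷ C) (false ∷ X) = ∣∣-partition C X
  ∣∣-partition (false ∷ C) (true  ∷ X) = ∣∣-partition C X
  ∣∣-partition (true  ∷ C) (false ∷ X) = trans (cong suc (∣∣-partition C X)) (sym (+-suc _ _))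
  ∣∣-partition (true  ∷ C) (true  ∷ X) = cong suc (∣∣-partition C X)

  ∣∣-split : ∀ {m} (S C : Subset m) → S ⊆ C → ∣ C ∣ ≡ ∣ S ∣ + ∣ C ─ S ∣
  ∣∣-split S C h = trans (∣∣-partition C S) (cong (_+ ∣ C ─ S ∣) (cong ∣_∣ C∩S≡S))
    where
    C∩S≡S : C ∩ S ≡ S
    C∩S≡S = ⊆-antisym (sub λ i q → proj₂ (∩e C S q)) (sub λ i q → ∩i C S (app h i q) q)

  ∩-comm : ∀ {m} (S T : Subset m) → S ∩ T ≡ T ∩ S
  ∩-comm S T = ext λ i → trans (!∩ S T i) (trans (∧-comm (S ! i) (T ! i)) (sym (!∩ T S i)))

  member-or-empty : ∀ {m} (S : Subset m) → (Σ (Fin m) λ i → S ! i ≡ true) ⊎ (∀ i → S ! i ≡ false)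
  member-or-empty []          = inj₂ λ ()
  member-or-empty (true  ∷ S) = inj₁ (zero , refl)
  member-or-empty (false ∷ S) with member-or-empty S
  ... | inj₁ (i , p) = inj₁ (suc i , p)
  ... | inj₂ h       = inj₂ λ { zero → refl ; (suc i) → h i }

  subset-induction : ∀ {m} (P : Subset m → Set) → P ⊥
                   → (∀ S e → S ! e ≡ false → P S → P (S ∪ ⁅ e ⁆)) → ∀ S → P S
  subset-induction P p⊥ p∪ S = go S (<-wellFounded ∣ S ∣)
    where
    go : ∀ S → Acc _<_ ∣ S ∣ → P S
    go S (acc rec) with member-or-empty S
    ... | inj₂ h       = subst P (ext λ i → trans (!⊥ i) (sym (h i))) p⊥
    ... | inj₁ (e , p) = subst P (-∪⁅⁆ S e p)
                           (p∪ (S - e) e (-self S e) (go (S - e) (rec (subst (∣ S - e ∣ <_) (sym (∣-∣ S e p)) ≤-refl))))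

  module _ {a} {A : Set a} where

    all⇒ : ∀ (p : A → Bool) xs → all p xs ≡ true → ∀ {x} → x ∈ˡ xs → p x ≡ true
    all⇒ p (y ∷ xs) h (here refl) = proj₁ (∧-elim h)
    all⇒ p (y ∷ xs) h (there x∈)  = all⇒ p xs (proj₂ (∧-elim {p y} h)) x∈

    all⇐ : ∀ (p : A → Bool) xs → (∀ {x} → x ∈ˡ xs → p x ≡ true) → all p xs ≡ true
    all⇐ p []       h = refl
    all⇐ p (y ∷ xs) h = ∧-intro (h (here refl)) (all⇐ p xs λ x∈ → h (there x∈))

    all≡false : ∀ (p : A → Bool) xs → all p xs ≡ false → Σ A λ x → x ∈ˡ xs × p x ≡ false
    all≡false p (y ∷ xs) h with p y in eq
    ... | false = y , here refl , eq
    ... | true with all≡false p xs h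
    ...   | x , x∈ , q = x , there x∈ , q

    any⇒ : ∀ (p : A → Bool) xs → any p xs ≡ true → Σ A λ x → x ∈ˡ xs × p x ≡ true
    any⇒ p (y ∷ xs) h with p y in eq
    ... | true  = y , here refl , eq
    ... | false with any⇒ p xs h
    ...   | x , x∈ , q = x , there x∈ , q

    any⇐ : ∀ (p : A → Bool) xs {x} → x ∈ˡ xs → p x ≡ true → any p xs ≡ true
    any⇐ p (y ∷ xs) (here refl) q = ∨-introˡ q
    any⇐ p (y ∷ xs) (there x∈)  q = ∨-introʳ {p y} (any⇐ p xs x∈ q)

    filter⇒ : ∀ (p : A → Bool) xs {x} → x ∈ˡ filterᵇ p xs → x ∈ˡ xs × p x ≡ true
    filter⇒ p (y ∷ xs) x∈ with p y in eq
    filter⇒ p (y ∷ xs) (here refl) | true = here refl , eq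
    filter⇒ p (y ∷ xs) (there x∈)  | true = let a , b = filter⇒ p xs x∈ in there a , b
    filter⇒ p (y ∷ xs) x∈          | false = let a , b = filter⇒ p xs x∈ in there a , b

    filter⇐ : ∀ (p : A → Bool) xs {x} → x ∈ˡ xs → p x ≡ true → x ∈ˡ filterᵇ p xs
    filter⇐ p (y ∷ xs) (here refl) q rewrite q = here refl
    filter⇐ p (y ∷ xs) (there x∈)  q with p y
    ... | true  = there (filter⇐ p xs x∈ q)
    ... | false = filter⇐ p xs x∈ q

  ∈-toList-tabulate : ∀ {a} {A : Set a} {k} (f : Fin k → A) i → f i ∈ˡ toList (tabulate f)
  ∈-toList-tabulate f zero    = here refl
  ∈-toList-tabulate f (suc i) = there (∈-toList-tabulate (λ j → f (suc j)) i)

  ∈-allFin : ∀ {k} (i : Fin k) → i ∈ˡ toList (allFin k)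
  ∈-allFin i = ∈-toList-tabulate (λ j → j) i

  allFin⇒ : ∀ {k} (p : Fin k → Bool) → all p (toList (allFin k)) ≡ true → ∀ i → p i ≡ true
  allFin⇒ {k} p h i = all⇒ p (toList (allFin k)) h (∈-allFin i)

  allFin⇐ : ∀ {k} (p : Fin k → Bool) → (∀ i → p i ≡ true) → all p (toList (allFin k)) ≡ true
  allFin⇐ {k} p h = all⇐ p (toList (allFin k)) λ {x} _ → h x

  allFin≡false : ∀ {k} (p : Fin k → Bool) → all p (toList (allFin k)) ≡ false → Σ (Fin k) λ i → p i ≡ false
  allFin≡false {k} p h = let x , _ , q = all≡false p (toList (allFin k)) h in x , q

  ∈-allSubsets : ∀ {k} (S : Subset k) → S ∈ˡ allSubsets k
  ∈-allSubsets {zero}  []          = here refl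
  ∈-allSubsets {suc k} (false ∷ S) = ∈-++⁺ˡ (∈-map⁺ (false ∷_) (∈-allSubsets S))
  ∈-allSubsets {suc k} (true  ∷ S) = ∈-++⁺ʳ (map (false ∷_) (allSubsets k)) (∈-map⁺ (true ∷_) (∈-allSubsets S))

  module _ {k : ℕ} where

    subsetᵇ⇒ : ∀ (S T : Subset k) → subsetᵇ S T ≡ true → S ⊆ T
    subsetᵇ⇒ S T h = sub f
      where
      f : ∀ i → S ! i ≡ true → T ! i ≡ true
      f i q with ∨-elim (allFin⇒ (λ i → not (S ! i) ∨ T ! i) h i)
      ... | inj₂ t = t
      ... | inj₁ t = ⊥-elim (true≢false (trans (sym q) (not-elim t)))

    subsetᵇ⇐ : ∀ (S T : Subset k) → S ⊆ T → subsetᵇ S T ≡ true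
    subsetᵇ⇐ S T h = allFin⇐ (λ i → not (S ! i) ∨ T ! i) f
      where
      f : ∀ i → not (S ! i) ∨ T ! i ≡ true
      f i with true⊎false (S ! i)
      ... | inj₁ q = ∨-introʳ {not (S ! i)} (app h i q)
      ... | inj₂ q = ∨-introˡ (not-intro q)

    eqSetᵇ⇒ : ∀ (S T : Subset k) → eqSetᵇ S T ≡ true → S ≡ T
    eqSetᵇ⇒ S T h = let a , b = ∧-elim h in ⊆-antisym (subsetᵇ⇒ S T a) (subsetᵇ⇒ T S b)

    eqSetᵇ-refl : ∀ (S : Subset k) → eqSetᵇ S S ≡ true
    eqSetᵇ-refl S = ∧-intro (subsetᵇ⇐ S S ⊆-refl) (subsetᵇ⇐ S S ⊆-refl)

    subsetsOf⇒ : ∀ (S T : Subset k) → T ∈ˡ subsetsOf S → T ⊆ S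
    subsetsOf⇒ S T T∈ = subsetᵇ⇒ T S (proj₂ (filter⇒ (λ T → subsetᵇ T S) (allSubsets k) T∈))

    subsetsOf⇐ : ∀ (S T : Subset k) → T ⊆ S → T ∈ˡ subsetsOf S
    subsetsOf⇐ S T h = filter⇐ (λ T → subsetᵇ T S) (allSubsets k) (∈-allSubsets T) (subsetᵇ⇐ T S h)

    minimalᵇ⇒ : ∀ (P : Subset k → Bool) S → minimalᵇ P S ≡ true
              → P S ≡ true × (∀ T → T ⊆ S → T ≢ S → P T ≡ false)
    minimalᵇ⇒ P S h = proj₁ (∧-elim h) , f
      where
      f : ∀ T → T ⊆ S → T ≢ S → P T ≡ false
      f T T⊆S ne with ∨-elim (all⇒ (λ T → eqSetᵇ T S ∨ not (P T)) (subsetsOf S) (proj₂ (∧-elim {P S} h)) (subsetsOf⇐ S T T⊆S))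
      ... | inj₁ q = ⊥-elim (ne (eqSetᵇ⇒ T S q))
      ... | inj₂ q = not-elim q

    minimal-below : ∀ (P : Subset k → Bool) S → P S ≡ true → Σ (Subset k) λ T → T ⊆ S × minimalᵇ P T ≡ true
    minimal-below P S₀ p₀ = go S₀ p₀ (<-wellFounded ∣ S₀ ∣)
      where
      others : Subset k → Bool
      others S = all (λ T → eqSetᵇ T S ∨ not (P T)) (subsetsOf S)

      go : ∀ S → P S ≡ true → Acc _<_ ∣ S ∣ → Σ (Subset k) λ T → T ⊆ S × minimalᵇ P T ≡ true
      go S p (acc rec) with true⊎false (minimalᵇ P S)
      ... | inj₁ q = S , ⊆-refl , q
      ... | inj₂ q with all≡false (λ T → eqSetᵇ T S ∨ not (P T)) (subsetsOf S)
                          (trans (cong (_∧ others S) (sym p)) q)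
      ...   | T , T∈ , f with go T pT (rec (⊂⇒∣∣< T S T⊆S T≢S))
        where
        T⊆S : T ⊆ S
        T⊆S = subsetsOf⇒ S T T∈
        T≢S : T ≢ S
        T≢S refl = true≢false (trans (sym (∨-introˡ {b = not (P T)} (eqSetᵇ-refl T))) f)
        pT : P T ≡ true
        pT = ≢false⇒≡true λ z → true≢false (trans (sym (∨-introʳ {eqSetᵇ T S} (not-intro z))) f)
      ...     | U , U⊆T , mU = U , ⊆-trans U⊆T (subsetsOf⇒ S T T∈) , mU

open BooleanSubsets

-- The only matroid axioms the argument needs; `GraphRank` establishes them for cycle matroids.
record RankAxioms {m : ℕ} (r : Subset m → ℕ) : Set where
  field
    r-empty   : r ⊥ ≡ 0
    r-unit    : ∀ X e → X ! e ≡ false → r (X ∪ ⁅ e ⁆) ≡ r X ⊎ r (X ∪ ⁅ e ⁆) ≡ suc (r X)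
    r-closure : ∀ X Y e → X ⊆ Y → r (X ∪ ⁅ e ⁆) ≡ r X → r (Y ∪ ⁅ e ⁆) ≡ r Y

module Matroid {m : ℕ} {r : Subset m → ℕ} (axioms : RankAxioms r) where
  open import Data.Bool using (true; false)
  open import Data.Nat using (ℕ; suc; _+_; _≤_; _<_; s≤s)
  open import Data.Nat.Properties
  open import Data.Fin using (Fin)
  open import Data.Fin.Subset using (Subset; ⁅_⁆; _∪_; _─_; _-_; ∣_∣; ⊥)
  open import Data.Fin.Subset.Properties using (∣⊥∣≡0)
  open import Data.Product using (_,_; proj₁)
  open import Data.Sum using (_⊎_; inj₁; inj₂)
  open import Data.Empty using (⊥-elim)
  open import Relation.Binary.PropositionalEquality hiding ([_])

  open RankAxioms axioms public

  _spans_ : Subset m → Fin m → Set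
  X spans e = r (X ∪ ⁅ e ⁆) ≡ r X

  Independent : Subset m → Set
  Independent X = r X ≡ ∣ X ∣

  r-step : ∀ X e → X spans e ⊎ r (X ∪ ⁅ e ⁆) ≡ suc (r X)
  r-step X e with X ! e in eq
  ... | true  = inj₁ (cong r (∪⁅⁆-absorb X e eq))
  ... | false = r-unit X e eq

  r-≤-∪⁅⁆ : ∀ X e → r X ≤ r (X ∪ ⁅ e ⁆)
  r-≤-∪⁅⁆ X e with r-step X e
  ... | inj₁ p = ≤-reflexive (sym p)
  ... | inj₂ p = ≤-trans (n≤1+n _) (≤-reflexive (sym p))

  r-∪⁅⁆-≤ : ∀ X e → r (X ∪ ⁅ e ⁆) ≤ suc (r X)
  r-∪⁅⁆-≤ X e with r-step X e
  ... | inj₁ p = ≤-trans (≤-reflexive p) (n≤1+n _)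
  ... | inj₂ p = ≤-reflexive p

  r-≤-∪ : ∀ X Z → r X ≤ r (X ∪ Z)
  r-≤-∪ X = subset-induction (λ Z → r X ≤ r (X ∪ Z))
    (≤-reflexive (cong r (sym (∪⊥ X))))
    λ S e _ ih → ≤-trans ih (≤-trans (r-≤-∪⁅⁆ (X ∪ S) e) (≤-reflexive (cong r (sym (∪-assoc-⁅⁆ X S e)))))

  r-mono : ∀ {X Y} → X ⊆ Y → r X ≤ r Y
  r-mono {X} {Y} h = ≤-trans (r-≤-∪ X Y) (≤-reflexive (cong r (∪-⊆-absorb h)))

  r-∪-≤ : ∀ X Z → r (X ∪ Z) ≤ r X + ∣ Z ∣
  r-∪-≤ X = subset-induction (λ Z → r (X ∪ Z) ≤ r X + ∣ Z ∣)
    (≤-trans (≤-reflexive (cong r (∪⊥ X))) (≤-trans (m≤m+n _ _) (≤-reflexive (cong (r X +_) (sym (∣⊥∣≡0 m))))))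
    λ S e e∉S ih → begin
      r (X ∪ (S ∪ ⁅ e ⁆)) ≡⟨ cong r (∪-assoc-⁅⁆ X S e) ⟩
      r ((X ∪ S) ∪ ⁅ e ⁆) ≤⟨ r-∪⁅⁆-≤ (X ∪ S) e ⟩
      suc (r (X ∪ S))     ≤⟨ s≤s ih ⟩
      suc (r X + ∣ S ∣)   ≡⟨ sym (+-suc (r X) ∣ S ∣) ⟩
      r X + suc ∣ S ∣     ≡⟨ cong (r X +_) (sym (∣∪⁅⁆∣ S e e∉S)) ⟩
      r X + ∣ S ∪ ⁅ e ⁆ ∣ ∎
    where open ≤-Reasoning

  r≤∣∣ : ∀ X → r X ≤ ∣ X ∣
  r≤∣∣ X = begin
    r X           ≡⟨ cong r (sym (⊥∪ X)) ⟩
    r (⊥ ∪ X)     ≤⟨ r-∪-≤ ⊥ X ⟩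
    r ⊥ + ∣ X ∣   ≡⟨ cong (_+ ∣ X ∣) r-empty ⟩
    ∣ X ∣         ∎
    where open ≤-Reasoning

  independent-⊆ : ∀ {C S} → Independent C → S ⊆ C → Independent S
  independent-⊆ {C} {S} rC h = ≤-antisym (r≤∣∣ S) (+-cancelʳ-≤ _ _ _ (begin
    ∣ S ∣ + ∣ C ─ S ∣   ≡⟨ sym (∣∣-split S C h) ⟩
    ∣ C ∣               ≡⟨ sym rC ⟩
    r C                 ≡⟨ cong r (sym (∪-─ S C h)) ⟩
    r (S ∪ (C ─ S))     ≤⟨ r-∪-≤ S (C ─ S) ⟩
    r S + ∣ C ─ S ∣     ∎))
    where open ≤-Reasoning

  spans-∪ : ∀ W Z → (∀ z → Z ! z ≡ true → W spans z) → r (W ∪ Z) ≡ r W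
  spans-∪ W = subset-induction (λ Z → (∀ z → Z ! z ≡ true → W spans z) → r (W ∪ Z) ≡ r W)
    (λ _ → cong r (∪⊥ W))
    λ S e _ ih h → trans (cong r (∪-assoc-⁅⁆ W S e))
                     (trans (r-closure W (W ∪ S) e (⊆∪l W S) (h e (∪⁅⁆-new S e)))
                            (ih λ z q → h z (∪l S ⁅ e ⁆ q)))

  Coloop : Subset m → Fin m → Set
  Coloop Q e = r (Q - e) < r Q

  coloops-deletion : ∀ Q R → R ⊆ Q → (∀ e → R ! e ≡ true → Coloop Q e) → r (Q ─ R) + ∣ R ∣ ≡ r Q
  coloops-deletion Q = subset-induction Deletable
    (λ _ _ → trans (cong₂ _+_ (cong r (─⊥ Q)) (∣⊥∣≡0 m)) (+-identityʳ _))
    delete-one-more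
    where
    Deletable : Subset m → Set
    Deletable R = R ⊆ Q → (∀ e → R ! e ≡ true → Coloop Q e) → r (Q ─ R) + ∣ R ∣ ≡ r Q

    delete-one-more : ∀ S e → S ! e ≡ false → Deletable S → Deletable (S ∪ ⁅ e ⁆)
    delete-one-more S e e∉S ih S+e⊆Q coloops = begin
      r (Q ─ (S ∪ ⁅ e ⁆)) + ∣ S ∪ ⁅ e ⁆ ∣ ≡⟨ cong₂ _+_ (cong r (─∪⁅⁆ Q S e)) (∣∪⁅⁆∣ S e e∉S) ⟩
      r Y + suc ∣ S ∣                     ≡⟨ +-suc (r Y) ∣ S ∣ ⟩
      suc (r Y) + ∣ S ∣                   ≡⟨ cong (_+ ∣ S ∣) (sym Q─S-drops) ⟩
      r (Q ─ S) + ∣ S ∣                   ≡⟨ ih (⊆-trans (⊆∪l S ⁅ e ⁆) S+e⊆Q) (λ e′ q → coloops e′ (∪l S ⁅ e ⁆ q)) ⟩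
      r Q                                 ∎
      where
      open ≡-Reasoning
      Y = (Q ─ S) - e
      e∈Q : Q ! e ≡ true
      e∈Q = app S+e⊆Q e (∪⁅⁆-new S e)
      Y⊆Q-e : Y ⊆ Q - e
      Y⊆Q-e = sub λ i q → let y , ne = -elim (Q ─ S) q in -intro Q (proj₁ (─e Q S y)) ne
      -- If Y spanned e, so would Q - e, and e would not be a coloop of Q.
      Q─S-drops : r (Q ─ S) ≡ suc (r Y)
      Q─S-drops with r-step Y e
      ... | inj₂ p = trans (cong r (sym (-∪⁅⁆ (Q ─ S) e (─i Q S e∈Q e∉S)))) p
      ... | inj₁ p = ⊥-elim (<-irrefl (sym (trans (cong r (sym (-∪⁅⁆ Q e e∈Q))) (r-closure Y (Q - e) e Y⊆Q-e p)))
                                       (coloops e (∪⁅⁆-new S e)))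

module Activities {m : ℕ} {r : Subset m → ℕ} (axioms : RankAxioms r) (A : Subset m) (label : Fin m → ℕ)
  (label-injective : ∀ g h → A ! g ≡ false → A ! h ≡ false → label g ≡ label h → g ≡ h)
  where
  open import Data.Bool using (Bool; true; false; _∧_; not; if_then_else_)
  open import Data.Bool.Properties using (∧-zeroʳ)
  open import Data.Nat using (ℕ; zero; suc; _+_; _∸_; _≤_; _<_; z≤n; _<ᵇ_; _≤ᵇ_; _≡ᵇ_)
  open import Data.Nat.Properties
  open import Data.Nat.Induction using (<-rec)
  open import Data.Fin using (Fin)
  open import Data.Fin.Properties using () renaming (_≟_ to _≟F_)
  open import Data.Fin.Subset using (Subset; ⁅_⁆; _∪_; _∩_; ∁; _─_; _-_; ∣_∣; ⊥)
  open import Data.Fin.Subset.Properties using (∣⊥∣≡0)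
  open import Data.Vec using (tabulate)
  open import Data.Product using (Σ; _×_; _,_; proj₁; proj₂)
  open import Data.Sum using (_⊎_; inj₁; inj₂; [_,_]′)
  open import Data.Empty using (⊥-elim)
  open import Relation.Nullary using (yes; no)
  open import Relation.Binary using (tri<; tri≈; tri>)
  open import Relation.Binary.PropositionalEquality hiding ([_])

  open Matroid axioms public

  Ground : Subset m
  Ground = tabulate λ _ → true

  ⊆Ground : ∀ {S} → S ⊆ Ground
  ⊆Ground = sub λ i _ → !tabulate (λ _ → true) i

  r≤r-Ground : ∀ S → r S ≤ r Ground
  r≤r-Ground S = r-mono ⊆Ground

  labelled : (ℕ → Bool) → Subset m
  labelled p = tabulate λ g → not (A ! g) ∧ p (label g)

  labelled-intro : ∀ {p h} → A ! h ≡ false → p (label h) ≡ true → labelled p ! h ≡ true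
  labelled-intro {p} {h} a q = trans (!tabulate (λ g → not (A ! g) ∧ p (label g)) h) (∧-intro (not-intro a) q)

  labelled-elim : ∀ {p h} → labelled p ! h ≡ true → A ! h ≡ false × p (label h) ≡ true
  labelled-elim {p} {h} q = let a , b = ∧-elim (trans (sym (!tabulate (λ g → not (A ! g) ∧ p (label g)) h)) q)
                            in not-elim a , b

  below above : Fin m → Subset m
  below e = labelled (_<ᵇ label e)
  above e = labelled (label e <ᵇ_)

  below-intro : ∀ {e h} → A ! h ≡ false → label h < label e → below e ! h ≡ true
  below-intro {e} a l = labelled-intro {_<ᵇ label e} a (<ᵇ-complete l)

  below-elim : ∀ {e h} → below e ! h ≡ true → A ! h ≡ false × label h < label e
  below-elim {e} q = let a , b = labelled-elim {_<ᵇ label e} q in a , <ᵇ-sound b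

  above-intro : ∀ {e h} → A ! h ≡ false → label e < label h → above e ! h ≡ true
  above-intro {e} a l = labelled-intro {label e <ᵇ_} a (<ᵇ-complete l)

  above-elim : ∀ {e h} → above e ! h ≡ true → A ! h ≡ false × label e < label h
  above-elim {e} q = let a , b = labelled-elim {label e <ᵇ_} q in a , <ᵇ-sound b

  labels-comparable : ∀ c g → A ! c ≡ false → A ! g ≡ false → c ≢ g → label g < label c ⊎ label c < label g
  labels-comparable c g ac ag ne with <-cmp (label g) (label c)
  ... | tri< lt _ _ = inj₁ lt
  ... | tri≈ _ eq _ = ⊥-elim (ne (label-injective c g ac ag (sym eq)))
  ... | tri> _ _ gt = inj₂ gt

  record Contracting (C : Subset m) : Set where
    constructor contracting
    field
      ⊆∁A         : C ⊆ ∁ A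
      independent : Independent C
      spanning    : r (C ∪ A) ≡ r Ground

  ∉A : ∀ {C e} → C ⊆ ∁ A → C ! e ≡ true → A ! e ≡ false
  ∉A C⊆ c = ∁e A (app C⊆ _ c)

  ∉C : ∀ {C e} → C ⊆ ∁ A → A ! e ≡ true → C ! e ≡ false
  ∉C C⊆ a = ≢true⇒≡false λ c → true≢false (trans (sym a) (∉A C⊆ c))

  -- The edges that a cocycle exhibiting e as internally active has to avoid.
  outsideCut : Subset m → Fin m → Subset m
  outsideCut C e = ((C - e) ∪ A) ∪ below e

  upper : Subset m → Fin m → Subset m
  upper C g = C ∩ above g

  InternallyActive : Subset m → Fin m → Set
  InternallyActive C e = r (outsideCut C e) < r Ground

  ExternallyActive : Subset m → Fin m → Set
  ExternallyActive C f = upper C f spans f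

  upper⊆ : ∀ C g → upper C g ⊆ C
  upper⊆ C g = ∩⊆l C (above g)

  upper∌ : ∀ C g → upper C g ! g ≡ false
  upper∌ C g = ≢true⇒≡false λ q → <-irrefl refl (proj₂ (above-elim (proj₂ (∩e C (above g) q))))

  C⊆upper∪below : ∀ C g → C ⊆ ∁ A → A ! g ≡ false
                → ∀ c → C ! c ≡ true → g ≢ c → ((upper C g ∪ A) ∪ below g) ! c ≡ true
  C⊆upper∪below C g C⊆ ag c cc ne with labels-comparable c g (∉A C⊆ cc) ag (λ eq → ne (sym eq))
  ... | inj₁ lt = ∪l (upper C g ∪ A) (below g) (∪l (upper C g) A (∩i C (above g) cc (above-intro (∉A C⊆ cc) lt)))
  ... | inj₂ lt = ∪r (upper C g ∪ A) (below g) (below-intro (∉A C⊆ cc) lt)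

  outsideCut-≡ : ∀ C g → C ⊆ ∁ A → A ! g ≡ false → outsideCut C g ≡ (upper C g ∪ A) ∪ below g
  outsideCut-≡ C g C⊆ ag = ⊆-antisym
    (∪⊆ (∪⊆ (sub λ c q → let cc , ne = -elim C q in C⊆upper∪below C g C⊆ ag c cc ne)
            (⊆-trans (⊆∪r (upper C g) A) (⊆∪l (upper C g ∪ A) (below g))))
        (⊆∪r (upper C g ∪ A) (below g)))
    (∪⊆ (∪⊆ (sub upper⊆C-g) (⊆-trans (⊆∪r (C - g) A) (⊆∪l ((C - g) ∪ A) (below g)))) (⊆∪r ((C - g) ∪ A) (below g)))
    where
    upper⊆C-g : ∀ c → upper C g ! c ≡ true → outsideCut C g ! c ≡ true
    upper⊆C-g c q = let cc , ac = ∩e C (above g) q in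
      ∪l ((C - g) ∪ A) (below g) (∪l (C - g) A (-intro C cc λ { refl → <-irrefl refl (proj₂ (above-elim ac)) }))

  C∪A⊆upper∪below : ∀ C g → C ⊆ ∁ A → C ! g ≡ false → A ! g ≡ false → C ∪ A ⊆ (upper C g ∪ A) ∪ below g
  C∪A⊆upper∪below C g C⊆ cg ag =
    ∪⊆ (sub λ c cc → C⊆upper∪below C g C⊆ ag c cc λ { refl → true≢false (trans (sym cc) cg) })
       (⊆-trans (⊆∪r (upper C g) A) (⊆∪l (upper C g ∪ A) (below g)))

  record Compatible (X C : Subset m) (e : Fin m) : Set where
    field
      zero-edge : A ! e ≡ true → X ! e ≡ false
      internal  : C ! e ≡ true → X ! e ≡ false → InternallyActive C e
      external  : A ! e ≡ false → C ! e ≡ false → X ! e ≡ true → ExternallyActive C e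

  -- Whether g must lie in C, given X and the part Q of C above g: for g ∈ X iff Q does not span g,
  -- for g ∉ X iff g would be internally active.
  choice : Subset m → Subset m → Fin m → Bool
  choice X Q g = if X ! g then r (Q ∪ ⁅ g ⁆) ≡ᵇ suc (r Q) else r ((Q ∪ A) ∪ below g) <ᵇ r Ground

  Determined : Subset m → Subset m → Fin m → Set
  Determined X C g = C ! g ≡ choice X (upper C g) g

  choice-∈ : ∀ X Q g → X ! g ≡ true → choice X Q g ≡ (r (Q ∪ ⁅ g ⁆) ≡ᵇ suc (r Q))
  choice-∈ X Q g p rewrite p = refl

  choice-∉ : ∀ X Q g → X ! g ≡ false → choice X Q g ≡ (r ((Q ∪ A) ∪ below g) <ᵇ r Ground)
  choice-∉ X Q g p rewrite p = refl

  n≡ᵇ1+n : ∀ n → (n ≡ᵇ suc n) ≡ false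
  n≡ᵇ1+n zero    = refl
  n≡ᵇ1+n (suc n) = n≡ᵇ1+n n

  compatible⇒determined : ∀ X C → Contracting C → (∀ e → Compatible X C e)
                        → ∀ g → A ! g ≡ false → Determined X C g
  compatible⇒determined X C (contracting C⊆ indep span) ok g ag
    with true⊎false (X ! g) | true⊎false (C ! g)
  ... | inj₁ xg | inj₁ cg = trans cg (sym (trans (choice-∈ X _ g xg) (≡ᵇ-complete upper-grows)))
    where
    upper-grows : r (upper C g ∪ ⁅ g ⁆) ≡ suc (r (upper C g))
    upper-grows = begin
      r (upper C g ∪ ⁅ g ⁆) ≡⟨ independent-⊆ indep (∪⁅⁆⊆ g (upper⊆ C g) cg) ⟩
      ∣ upper C g ∪ ⁅ g ⁆ ∣ ≡⟨ ∣∪⁅⁆∣ (upper C g) g (upper∌ C g) ⟩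
      suc ∣ upper C g ∣     ≡⟨ cong suc (sym (independent-⊆ indep (upper⊆ C g))) ⟩
      suc (r (upper C g))   ∎
      where open ≡-Reasoning
  ... | inj₁ xg | inj₂ cg = trans cg (sym (trans (choice-∈ X _ g xg)
         (trans (cong (_≡ᵇ suc (r (upper C g))) (Compatible.external (ok g) ag cg xg)) (n≡ᵇ1+n (r (upper C g))))))
  ... | inj₂ xg | inj₁ cg = trans cg (sym (trans (choice-∉ X _ g xg)
         (<ᵇ-complete (subst (λ W → r W < r Ground) (outsideCut-≡ C g C⊆ ag) (Compatible.internal (ok g) cg xg)))))
  ... | inj₂ xg | inj₂ cg = trans cg (sym (trans (choice-∉ X _ g xg) (≢true⇒≡false λ q →
         <-irrefl refl (<-≤-trans (<ᵇ-sound q)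
           (≤-trans (≤-reflexive (sym span)) (r-mono (C∪A⊆upper∪below C g C⊆ cg ag)))))))

  determined⇒compatible : ∀ X C → X ⊆ ∁ A → C ⊆ ∁ A → (∀ g → A ! g ≡ false → Determined X C g)
                        → ∀ e → Compatible X C e
  determined⇒compatible X C X⊆ C⊆ det e = record
    { zero-edge = λ ae → ∉C X⊆ ae
    ; internal  = λ ce xe → let ae = ∉A C⊆ ce in
        subst (λ W → r W < r Ground) (sym (outsideCut-≡ C e C⊆ ae))
          (<ᵇ-sound (trans (sym (choice-∉ X _ e xe)) (trans (sym (det e ae)) ce)))
    ; external  = external
    }
    where
    external : A ! e ≡ false → C ! e ≡ false → X ! e ≡ true → ExternallyActive C e
    external ae ce xe with r-step (upper C e) e
    ... | inj₁ p = p
    ... | inj₂ p = ⊥-elim (true≢false (trans (sym (≡ᵇ-complete p))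
                     (trans (sym (choice-∈ X _ e xe)) (trans (sym (det e ae)) ce))))

  label-bound : ℕ
  label-bound = proj₁ (bounded label)

  label<bound : ∀ g → label g < label-bound
  label<bound = proj₂ (bounded label)

  -- Descending induction on labels: two determined sets agree above g, hence at g.
  determined-unique : ∀ X C C′ → C ⊆ ∁ A → C′ ⊆ ∁ A → (∀ g → A ! g ≡ false → Determined X C g)
                    → (∀ g → A ! g ≡ false → Determined X C′ g) → C ≡ C′
  determined-unique X C C′ C⊆ C′⊆ det det′ = ext agree
    where
    AgreeAt : ℕ → Set
    AgreeAt k = ∀ g → A ! g ≡ false → label-bound ∸ label g ≡ k → C ! g ≡ C′ ! g

    agree-at : ∀ k → (∀ {j} → j < k → AgreeAt j) → AgreeAt k
    agree-at k ih g ag refl = trans (det g ag) (trans (cong (λ U → choice X U g) same-upper) (sym (det′ g ag)))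
      where
      same-upper : upper C g ≡ upper C′ g
      same-upper = ext λ i → trans (!∩ C (above g) i) (trans (agree-∧ i (above g ! i) refl) (sym (!∩ C′ (above g) i)))
        where
        agree-∧ : ∀ i b → above g ! i ≡ b → C ! i ∧ above g ! i ≡ C′ ! i ∧ above g ! i
        agree-∧ i false eq rewrite eq = trans (∧-zeroʳ _) (sym (∧-zeroʳ _))
        agree-∧ i true  eq = let ai , lt = above-elim eq in
          cong (_∧ above g ! i) (ih (∸-monoʳ-< lt (<⇒≤ (label<bound i))) i ai refl)

    agree : ∀ g → C ! g ≡ C′ ! g
    agree g with true⊎false (A ! g)
    ... | inj₁ ag = trans (∉C C⊆ ag) (sym (∉C C′⊆ ag))
    ... | inj₂ ag = <-rec AgreeAt agree-at (label-bound ∸ label g) g ag refl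

  atLeast lessThan exactly : ℕ → Subset m
  atLeast  s = labelled (s ≤ᵇ_)
  lessThan s = labelled (_<ᵇ s)
  exactly  s = labelled (_≡ᵇ s)

  atLeast-intro : ∀ {s h} → A ! h ≡ false → s ≤ label h → atLeast s ! h ≡ true
  atLeast-intro {s} a l = labelled-intro {s ≤ᵇ_} a (≤ᵇ-complete l)

  atLeast-elim : ∀ {s h} → atLeast s ! h ≡ true → A ! h ≡ false × s ≤ label h
  atLeast-elim {s} q = let a , b = labelled-elim {s ≤ᵇ_} q in a , ≤ᵇ-sound b

  lessThan-intro : ∀ {s h} → A ! h ≡ false → label h < s → lessThan s ! h ≡ true
  lessThan-intro {s} a l = labelled-intro {_<ᵇ s} a (<ᵇ-complete l)

  lessThan-elim : ∀ {s h} → lessThan s ! h ≡ true → A ! h ≡ false × label h < s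
  lessThan-elim {s} q = let a , b = labelled-elim {_<ᵇ s} q in a , <ᵇ-sound b

  atLeast-suc⊆ : ∀ s → atLeast (suc s) ⊆ atLeast s
  atLeast-suc⊆ s = sub λ i q → let a , l = atLeast-elim q in atLeast-intro a (<⇒≤ l)

  -- X ↦ C is built greedily, deciding the edges in order of decreasing label.
  module Construction (X : Subset m) (X⊆ : X ⊆ ∁ A) where

    record Partial (s : ℕ) : Set where
      constructor partial
      field
        C          : Subset m
        C⊆         : C ⊆ atLeast s
        indep      : Independent C
        spanning   : r ((C ∪ A) ∪ lessThan s) ≡ r Ground
        determined : ∀ g → A ! g ≡ false → s ≤ label g → Determined X C g

    partial-top : ∀ s → label-bound ≤ s → Partial s
    partial-top s bound≤s = partial ⊥ ⊥⊆ (trans r-empty (sym (∣⊥∣≡0 m))) (cong r (⊆-antisym ⊆Ground (sub all-below)))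
      λ g ag s≤g → ⊥-elim (<-irrefl refl (<-≤-trans (label<bound g) (≤-trans bound≤s s≤g)))
      where
      all-below : ∀ i → Ground ! i ≡ true → ((⊥ ∪ A) ∪ lessThan s) ! i ≡ true
      all-below i _ with true⊎false (A ! i)
      ... | inj₁ a = ∪l (⊥ ∪ A) (lessThan s) (∪r ⊥ A a)
      ... | inj₂ a = ∪r (⊥ ∪ A) (lessThan s) (lessThan-intro a (<-≤-trans (label<bound i) bound≤s))

    partial-skip : ∀ s → (∀ g → A ! g ≡ false → label g ≢ s) → Partial (suc s) → Partial s
    partial-skip s no-s (partial C C⊆ indep span det) =
      partial C (⊆-trans C⊆ (atLeast-suc⊆ s)) indep (trans (cong (λ L → r ((C ∪ A) ∪ L)) same) span)
        λ g ag s≤g → det g ag (≤∧≢⇒< s≤g λ eq → no-s g ag (sym eq))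
      where
      same : lessThan s ≡ lessThan (suc s)
      same = ⊆-antisym (sub λ i q → let a , l = lessThan-elim q in lessThan-intro a (≤-trans l (n≤1+n _)))
                       (sub λ i q → let a , l = lessThan-elim q in lessThan-intro a (≤∧≢⇒< (≤-pred l) (no-s i a)))

    module AtEdge (s : ℕ) (g₀ : Fin m) (a₀ : A ! g₀ ≡ false) (l₀ : label g₀ ≡ s) (P : Partial (suc s)) where
      open Partial P

      g₀∉C : C ! g₀ ≡ false
      g₀∉C = ≢true⇒≡false λ q → <-irrefl (sym l₀) (proj₂ (atLeast-elim (app C⊆ g₀ q)))

      upper-g₀ : upper C g₀ ≡ C
      upper-g₀ = ⊆-antisym (upper⊆ C g₀) (sub λ i q → let a , l = atLeast-elim (app C⊆ i q) in
                   ∩i C (above g₀) q (above-intro a (subst (_< label i) (sym l₀) l)))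

      upper-∪⁅g₀⁆ : ∀ Q g → label g₀ ≤ label g → upper (Q ∪ ⁅ g₀ ⁆) g ≡ upper Q g
      upper-∪⁅g₀⁆ Q g g₀≤g = ext λ i → trans (!∩ (Q ∪ ⁅ g₀ ⁆) (above g) i) (trans (same i) (sym (!∩ Q (above g) i)))
        where
        g₀∉above : above g ! g₀ ≡ false
        g₀∉above = ≢true⇒≡false λ q → <-irrefl refl (<-≤-trans (proj₂ (above-elim q)) g₀≤g)
        same : ∀ i → (Q ∪ ⁅ g₀ ⁆) ! i ∧ above g ! i ≡ Q ! i ∧ above g ! i
        same i with g₀ ≟F i
        ... | no ne    = cong (_∧ above g ! i) (∪⁅⁆-other Q g₀ i ne)
        ... | yes refl = trans (cong ((Q ∪ ⁅ g₀ ⁆) ! g₀ ∧_) g₀∉above)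
                           (trans (∧-zeroʳ _) (sym (trans (cong (Q ! g₀ ∧_) g₀∉above) (∧-zeroʳ _))))

      higher : ∀ g → A ! g ≡ false → s ≤ label g → g₀ ≢ g → suc s ≤ label g
      higher g ag s≤g ne = ≤∧≢⇒< s≤g λ eq → ne (label-injective g₀ g a₀ ag (trans l₀ eq))

      Y : Subset m
      Y = (C ∪ A) ∪ below g₀

      C⊆Y : C ⊆ Y
      C⊆Y = ⊆-trans (⊆∪l C A) (⊆∪l (C ∪ A) (below g₀))

      lessThan-s : lessThan s ≡ below g₀
      lessThan-s = ⊆-antisym (sub λ i q → let a , l = lessThan-elim q in below-intro a (subst (label i <_) (sym l₀) l))
                             (sub λ i q → let a , l = below-elim q in lessThan-intro a (subst (label i <_) l₀ l))

      lessThan-suc : (C ∪ A) ∪ lessThan (suc s) ≡ Y ∪ ⁅ g₀ ⁆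
      lessThan-suc = ⊆-antisym (∪⊆ (⊆-trans (⊆∪l (C ∪ A) (below g₀)) (⊆∪l Y ⁅ g₀ ⁆)) (sub into)) (sub back)
        where
        into : ∀ i → lessThan (suc s) ! i ≡ true → (Y ∪ ⁅ g₀ ⁆) ! i ≡ true
        into i q with lessThan-elim q | g₀ ≟F i
        ... | a , l | yes refl = ∪⁅⁆-new Y g₀
        ... | a , l | no ne    = ∪l Y ⁅ g₀ ⁆ (∪r (C ∪ A) (below g₀) (below-intro a (subst (label i <_) (sym l₀)
                                   (≤∧≢⇒< (≤-pred l) λ eq → ne (label-injective g₀ i a₀ a (trans l₀ (sym eq)))))))
        back : ∀ i → (Y ∪ ⁅ g₀ ⁆) ! i ≡ true → ((C ∪ A) ∪ lessThan (suc s)) ! i ≡ true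
        back i q with ∪⁅⁆-elim Y g₀ i q
        ... | inj₂ refl = ∪r (C ∪ A) (lessThan (suc s)) (lessThan-intro a₀ (≤-reflexive (cong suc l₀)))
        ... | inj₁ y with ∪e (C ∪ A) (below g₀) y
        ...   | inj₁ z = ∪l (C ∪ A) (lessThan (suc s)) z
        ...   | inj₂ z = let a , l = below-elim z in
                  ∪r (C ∪ A) (lessThan (suc s)) (lessThan-intro a (≤-trans (subst (label i <_) l₀ l) (n≤1+n _)))

      r-Y∪g₀ : r (Y ∪ ⁅ g₀ ⁆) ≡ r Ground
      r-Y∪g₀ = trans (cong r (sym lessThan-suc)) spanning

      partial-add : choice X C g₀ ≡ true → Partial s
      partial-add chosen = partial (C ∪ ⁅ g₀ ⁆)
        (∪⁅⁆⊆ g₀ (⊆-trans C⊆ (atLeast-suc⊆ s)) (atLeast-intro a₀ (≤-reflexive (sym l₀))))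
        (trans grows (trans (cong suc indep) (sym (∣∪⁅⁆∣ C g₀ g₀∉C))))
        (trans (cong r span-same) spanning)
        det
        where
        grows : r (C ∪ ⁅ g₀ ⁆) ≡ suc (r C)
        grows with true⊎false (X ! g₀)
        ... | inj₁ x = ≡ᵇ-sound (trans (sym (choice-∈ X C g₀ x)) chosen)
        ... | inj₂ x with r-step C g₀
        ...   | inj₂ q = q
        ...   | inj₁ q = ⊥-elim (<-irrefl (sym (trans (sym r-Y∪g₀) (r-closure C Y g₀ C⊆Y q)))
                                          (<ᵇ-sound (trans (sym (choice-∉ X C g₀ x)) chosen)))
        span-same : ((C ∪ ⁅ g₀ ⁆) ∪ A) ∪ lessThan s ≡ (C ∪ A) ∪ lessThan (suc s)
        span-same = trans (cong (((C ∪ ⁅ g₀ ⁆) ∪ A) ∪_) lessThan-s) (trans regroup (sym lessThan-suc))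
          where
          regroup : ((C ∪ ⁅ g₀ ⁆) ∪ A) ∪ below g₀ ≡ Y ∪ ⁅ g₀ ⁆
          regroup = ⊆-antisym
            (∪⊆ (∪⊆ (∪⁅⁆⊆ g₀ (⊆-trans C⊆Y (⊆∪l Y ⁅ g₀ ⁆)) (∪⁅⁆-new Y g₀))
                    (⊆-trans (⊆-trans (⊆∪r C A) (⊆∪l (C ∪ A) (below g₀))) (⊆∪l Y ⁅ g₀ ⁆)))
                (⊆-trans (⊆∪r (C ∪ A) (below g₀)) (⊆∪l Y ⁅ g₀ ⁆)))
            (∪⁅⁆⊆ g₀ (∪⊆ (∪⊆ (⊆-trans (⊆∪l C ⁅ g₀ ⁆) (⊆-trans (⊆∪l (C ∪ ⁅ g₀ ⁆) A) (⊆∪l _ (below g₀))))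
                                  (⊆-trans (⊆∪r (C ∪ ⁅ g₀ ⁆) A) (⊆∪l _ (below g₀))))
                              (⊆∪r ((C ∪ ⁅ g₀ ⁆) ∪ A) (below g₀)))
                     (∪l ((C ∪ ⁅ g₀ ⁆) ∪ A) (below g₀) (∪l (C ∪ ⁅ g₀ ⁆) A (∪⁅⁆-new C g₀))))
        det : ∀ g → A ! g ≡ false → s ≤ label g → Determined X (C ∪ ⁅ g₀ ⁆) g
        det g ag s≤g with g₀ ≟F g
        ... | yes refl = trans (∪⁅⁆-new C g₀)
                           (sym (trans (cong (λ U → choice X U g₀) (trans (upper-∪⁅g₀⁆ C g₀ ≤-refl) upper-g₀)) chosen))
        ... | no ne    = trans (∪⁅⁆-other C g₀ g ne) (trans (determined g ag higher-g)
                           (cong (λ U → choice X U g) (sym (upper-∪⁅g₀⁆ C g (≤-trans (≤-reflexive l₀) (<⇒≤ higher-g))))))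
          where higher-g = higher g ag s≤g ne

      partial-keep : choice X C g₀ ≡ false → Partial s
      partial-keep rejected = partial C (⊆-trans C⊆ (atLeast-suc⊆ s)) indep
        (trans (cong (λ L → r ((C ∪ A) ∪ L)) lessThan-s) r-Y) det
        where
        r-Y : r Y ≡ r Ground
        r-Y with true⊎false (X ! g₀)
        ... | inj₁ x with r-step C g₀
        ...   | inj₁ q = trans (sym (r-closure C Y g₀ C⊆Y q)) r-Y∪g₀
        ...   | inj₂ q = ⊥-elim (true≢false (trans (sym (≡ᵇ-complete q)) (trans (sym (choice-∈ X C g₀ x)) rejected)))
        r-Y | inj₂ x = ≤-antisym (r≤r-Ground Y) (≮⇒≥ (<ᵇ-false (trans (sym (choice-∉ X C g₀ x)) rejected)))
        det : ∀ g → A ! g ≡ false → s ≤ label g → Determined X C g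
        det g ag s≤g with g₀ ≟F g
        ... | yes refl = trans g₀∉C (sym (trans (cong (λ U → choice X U g₀) upper-g₀) rejected))
        ... | no ne    = determined g ag (higher g ag s≤g ne)

    partial-step : ∀ s → Partial (suc s) → Partial s
    partial-step s P with member-or-empty (exactly s)
    ... | inj₂ none = partial-skip s no-s P
      where
      no-s : ∀ g → A ! g ≡ false → label g ≢ s
      no-s g ag eq = true≢false (trans (sym (labelled-intro {_≡ᵇ s} ag (≡ᵇ-complete eq))) (none g))
    ... | inj₁ (g₀ , p) with labelled-elim {_≡ᵇ s} p
    ...   | a₀ , l₀ with true⊎false (choice X (Partial.C P) g₀)
    ...     | inj₁ c = AtEdge.partial-add  s g₀ a₀ (≡ᵇ-sound l₀) P c
    ...     | inj₂ c = AtEdge.partial-keep s g₀ a₀ (≡ᵇ-sound l₀) P c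

    partial-from : ∀ d s → label-bound ≤ s + d → Partial s
    partial-from zero    s h = partial-top s (subst (label-bound ≤_) (+-identityʳ s) h)
    partial-from (suc d) s h = partial-step s (partial-from d (suc s) (subst (label-bound ≤_) (+-suc s d) h))

    compatible-exists : Σ (Subset m) λ C → Contracting C × (∀ e → Compatible X C e)
    compatible-exists with partial-from label-bound 0 ≤-refl
    ... | partial C C⊆ indep span det =
      C , contracting C⊆∁A indep (trans (cong r (sym nothing-below-0)) span)
        , determined⇒compatible X C X⊆ C⊆∁A λ g ag → det g ag z≤n
      where
      C⊆∁A : C ⊆ ∁ A
      C⊆∁A = sub λ i q → ∁i A (proj₁ (atLeast-elim {0} (app C⊆ i q)))
      nothing-below-0 : (C ∪ A) ∪ lessThan 0 ≡ C ∪ A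
      nothing-below-0 = ⊆-antisym (∪⊆ ⊆-refl (sub λ i q → ⊥-elim (<-irrefl refl (≤-trans (proj₂ (lessThan-elim q)) z≤n))))
                                  (⊆∪l (C ∪ A) (lessThan 0))

  compatible-unique : ∀ X C C′ → Contracting C → Contracting C′
                    → (∀ e → Compatible X C e) → (∀ e → Compatible X C′ e) → C ≡ C′
  compatible-unique X C C′ cC cC′ ok ok′ =
    determined-unique X C C′ (Contracting.⊆∁A cC) (Contracting.⊆∁A cC′)
      (compatible⇒determined X C cC ok) (compatible⇒determined X C′ cC′ ok′)

  -- Every e ∈ C ─ X is a coloop of X ∪ C and of (X ∪ A) ∪ C, being internally active, while the
  -- edges of X ─ C are spanned by the part of C above them; deleting C ─ X gives both identities.
  module RankIdentities (X C : Subset m) (cC : Contracting C) (ok : ∀ e → Compatible X C e) where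
    open Contracting cC
    open Compatible

    X⊆∁A : X ⊆ ∁ A
    X⊆∁A = sub λ i x → ∁i A (≢true⇒≡false λ a → true≢false (trans (sym x) (zero-edge (ok i) a)))

    C─X-active : ∀ e → (C ─ X) ! e ≡ true → InternallyActive C e
    C─X-active e q = let ce , xe = ─e C X q in internal (ok e) ce xe

    X─C-active : ∀ f → (X ─ C) ! f ≡ true → ExternallyActive C f
    X─C-active f q = let xf , cf = ─e X C q in external (ok f) (∉A X⊆∁A xf) cf xf

    r-outsideCut∪e : ∀ e → C ! e ≡ true → r (outsideCut C e ∪ ⁅ e ⁆) ≡ r Ground
    r-outsideCut∪e e ce = ≤-antisym (r≤r-Ground _) (≤-trans (≤-reflexive (sym spanning)) (r-mono (sub f)))
      where
      f : ∀ i → (C ∪ A) ! i ≡ true → (outsideCut C e ∪ ⁅ e ⁆) ! i ≡ true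
      f i q with ∪e C A q | e ≟F i
      ... | _      | yes refl = ∪⁅⁆-new (outsideCut C e) e
      ... | inj₁ c | no ne    = ∪l (outsideCut C e) ⁅ e ⁆ (∪l ((C - e) ∪ A) (below e) (∪l (C - e) A (-intro C c ne)))
      ... | inj₂ a | no ne    = ∪l (outsideCut C e) ⁅ e ⁆ (∪l ((C - e) ∪ A) (below e) (∪r (C - e) A a))

    X─C-above : Fin m → Subset m
    X─C-above e = (X ─ C) ∩ above e

    X─C-above-spanned : ∀ e (W : Subset m) → C - e ⊆ W → ∀ z → X─C-above e ! z ≡ true → W spans z
    X─C-above-spanned e W C-e⊆W z q =
      let xz , az = ∩e (X ─ C) (above e) q in r-closure (upper C z) W z (⊆-trans (upper⊆C-e z (proj₂ (above-elim az))) C-e⊆W) (X─C-active z xz)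
      where
      upper⊆C-e : ∀ z → label e < label z → upper C z ⊆ C - e
      upper⊆C-e z lt = sub λ c q → let cc , ac = ∩e C (above z) q in
        -intro C cc λ { refl → <-irrefl refl (<-trans lt (proj₂ (above-elim ac))) }

    X∪C : Subset m
    X∪C = X ∪ C

    r-X∪C : r X∪C ≡ ∣ C ∣
    r-X∪C = trans (cong r X∪C≡C∪[X─C]) (trans (spans-∪ C (X ─ C) λ z q → r-closure (upper C z) C z (upper⊆ C z) (X─C-active z q)) independent)
      where
      X∪C≡C∪[X─C] : X∪C ≡ C ∪ (X ─ C)
      X∪C≡C∪[X─C] = ⊆-antisym (sub f) (∪⊆ (⊆∪r X C) (⊆-trans (─⊆ X C) (⊆∪l X C)))
        where
        f : ∀ i → X∪C ! i ≡ true → (C ∪ (X ─ C)) ! i ≡ true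
        f i q with true⊎false (C ! i) | ∪e X C q
        ... | inj₁ c | _      = ∪l C (X ─ C) c
        ... | inj₂ c | inj₁ x = ∪r C (X ─ C) (─i X C x c)
        ... | inj₂ c | inj₂ c′ = ⊥-elim (true≢false (trans (sym c′) c))

    coloop-X∪C : ∀ e → (C ─ X) ! e ≡ true → Coloop X∪C e
    coloop-X∪C e q = begin-strict
      r (X∪C - e)                ≤⟨ r-mono (sub covered) ⟩
      r (Y ∪ X─C-above e)        ≡⟨ spans-∪ Y (X─C-above e) (X─C-above-spanned e Y (⊆∪l (C - e) lowerX)) ⟩
      r Y                        <⟨ ≤-reflexive (sym Y-grows) ⟩
      r (Y ∪ ⁅ e ⁆)              ≤⟨ r-mono (∪⁅⁆⊆ e (∪⊆ (⊆-trans (-⊆ C e) (⊆∪r X C)) (⊆-trans (∩⊆l (X ─ C) (below e)) (⊆-trans (─⊆ X C) (⊆∪l X C)))) (∪r X C ce)) ⟩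
      r X∪C                      ∎
      where
      open ≤-Reasoning
      ce = proj₁ (─e C X q)
      lowerX = (X ─ C) ∩ below e
      Y = (C - e) ∪ lowerX
      Y⊆outsideCut : Y ⊆ outsideCut C e
      Y⊆outsideCut = ∪⊆ (⊆-trans (⊆∪l (C - e) A) (⊆∪l ((C - e) ∪ A) (below e)))
                        (sub λ i q′ → ∪r ((C - e) ∪ A) (below e) (proj₂ (∩e (X ─ C) (below e) q′)))
      Y-grows : r (Y ∪ ⁅ e ⁆) ≡ suc (r Y)
      Y-grows with r-step Y e
      ... | inj₂ p = p
      ... | inj₁ p = ⊥-elim (<-irrefl (sym (trans (sym (r-outsideCut∪e e ce)) (r-closure Y (outsideCut C e) e Y⊆outsideCut p)))
                                      (C─X-active e q))
      covered : ∀ i → (X∪C - e) ! i ≡ true → (Y ∪ X─C-above e) ! i ≡ true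
      covered i q′ with -elim X∪C q′
      ... | qi , ne with true⊎false (C ! i) | ∪e X C qi
      ...   | inj₁ c | _       = ∪l Y (X─C-above e) (∪l (C - e) lowerX (-intro C c ne))
      ...   | inj₂ c | inj₂ c′ = ⊥-elim (true≢false (trans (sym c′) c))
      ...   | inj₂ c | inj₁ x with labels-comparable i e (∉A X⊆∁A x) (∉A ⊆∁A ce) (λ eq → ne (sym eq))
      ...     | inj₁ lt = ∪r Y (X─C-above e) (∩i (X ─ C) (above e) (─i X C x c) (above-intro (∉A X⊆∁A x) lt))
      ...     | inj₂ lt = ∪l Y (X─C-above e) (∪r (C - e) lowerX (∩i (X ─ C) (below e) (─i X C x c) (below-intro (∉A X⊆∁A x) lt)))

    rank-X : r X ≡ ∣ C ∩ X ∣
    rank-X = +-cancelʳ-≡ (∣ C ─ X ∣) (r X) (∣ C ∩ X ∣) (begin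
      r X + ∣ C ─ X ∣           ≡⟨ cong (λ S → r S + ∣ C ─ X ∣) (sym (∪── X C)) ⟩
      r (X∪C ─ (C ─ X)) + ∣ C ─ X ∣ ≡⟨ coloops-deletion X∪C (C ─ X) (⊆-trans (─⊆ C X) (⊆∪r X C)) coloop-X∪C ⟩
      r X∪C                     ≡⟨ r-X∪C ⟩
      ∣ C ∣                     ≡⟨ ∣∣-partition C X ⟩
      ∣ C ∩ X ∣ + ∣ C ─ X ∣     ∎)
      where open ≡-Reasoning

    X∪A∪C : Subset m
    X∪A∪C = (X ∪ A) ∪ C

    r-X∪A∪C : r X∪A∪C ≡ r Ground
    r-X∪A∪C = ≤-antisym (r≤r-Ground X∪A∪C)
      (≤-trans (≤-reflexive (sym spanning)) (r-mono (∪⊆ (⊆∪r (X ∪ A) C) (⊆-trans (⊆∪r X A) (⊆∪l (X ∪ A) C)))))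

    coloop-X∪A∪C : ∀ e → (C ─ X) ! e ≡ true → Coloop X∪A∪C e
    coloop-X∪A∪C e q = begin-strict
      r (X∪A∪C - e)                       ≤⟨ r-mono (sub covered) ⟩
      r (outsideCut C e ∪ X─C-above e)    ≡⟨ spans-∪ (outsideCut C e) (X─C-above e) (X─C-above-spanned e (outsideCut C e) C-e⊆) ⟩
      r (outsideCut C e)                  <⟨ C─X-active e q ⟩
      r Ground                            ≡⟨ sym r-X∪A∪C ⟩
      r X∪A∪C                             ∎
      where
      open ≤-Reasoning
      ce = proj₁ (─e C X q)
      W = outsideCut C e
      C-e⊆ : C - e ⊆ W
      C-e⊆ = ⊆-trans (⊆∪l (C - e) A) (⊆∪l ((C - e) ∪ A) (below e))
      covered : ∀ i → (X∪A∪C - e) ! i ≡ true → (W ∪ X─C-above e) ! i ≡ true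
      covered i q′ with -elim X∪A∪C q′
      ... | qi , ne with true⊎false (C ! i) | ∪e (X ∪ A) C qi
      ...   | inj₁ c | _       = ∪l W (X─C-above e) (app C-e⊆ i (-intro C c ne))
      ...   | inj₂ c | inj₂ c′ = ⊥-elim (true≢false (trans (sym c′) c))
      ...   | inj₂ c | inj₁ xa with ∪e X A xa
      ...     | inj₂ a = ∪l W (X─C-above e) (∪l ((C - e) ∪ A) (below e) (∪r (C - e) A a))
      ...     | inj₁ x with labels-comparable i e (∉A X⊆∁A x) (∉A ⊆∁A ce) (λ eq → ne (sym eq))
      ...       | inj₁ lt = ∪r W (X─C-above e) (∩i (X ─ C) (above e) (─i X C x c) (above-intro (∉A X⊆∁A x) lt))
      ...       | inj₂ lt = ∪l W (X─C-above e) (∪r ((C - e) ∪ A) (below e) (below-intro (∉A X⊆∁A x) lt))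

    C─[X∪A]≡C─X : C ─ (X ∪ A) ≡ C ─ X
    C─[X∪A]≡C─X = ⊆-antisym (sub λ i q → let c , n = ─e C (X ∪ A) q in ─i C X c (≢true⇒≡false λ x → true≢false (trans (sym (∪l X A x)) n)))
      (sub λ i q → let c , n = ─e C X q in
         ─i C (X ∪ A) c (≢true⇒≡false λ xa → [ (λ x → true≢false (trans (sym x) n)) , (λ a → true≢false (trans (sym a) (∉A ⊆∁A c))) ]′ (∪e X A xa)))

    rank-X∪A : r (X ∪ A) + ∣ C ─ X ∣ ≡ r Ground
    rank-X∪A = begin
      r (X ∪ A) + ∣ C ─ X ∣               ≡⟨ cong (λ S → r S + ∣ C ─ X ∣) (sym (∪── (X ∪ A) C)) ⟩
      r (X∪A∪C ─ (C ─ (X ∪ A))) + ∣ C ─ X ∣ ≡⟨ cong (λ S → r (X∪A∪C ─ S) + ∣ C ─ X ∣) C─[X∪A]≡C─X ⟩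
      r (X∪A∪C ─ (C ─ X)) + ∣ C ─ X ∣     ≡⟨ coloops-deletion X∪A∪C (C ─ X) (⊆-trans (─⊆ C X) (⊆∪r (X ∪ A) C)) coloop-X∪A∪C ⟩
      r X∪A∪C                             ≡⟨ r-X∪A∪C ⟩
      r Ground                            ∎
      where open ≡-Reasoning

module GraphRank (G : Graph) where
  open import Defs using (Graph; step; iter; reach; isRep; components; rank)
  open import Data.Bool using (Bool; true; false; _∨_; not; if_then_else_)
  open import Data.Nat using (zero; suc; _∸_; _≤_; _<_; z≤n; s≤s; _≤ᵇ_)
  open import Data.Nat.Properties
  open import Data.Fin using (Fin; zero; suc; toℕ)
  open import Data.Fin.Properties using (toℕ-injective)
  open import Data.Fin.Subset using (Subset; ⁅_⁆; _∪_; ∣_∣; ⊥; ⊤)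
  open import Data.Fin.Subset.Properties using (∣p∣≤n; ∣⊤∣≡n; ∣⁅x⁆∣≡1)
  open import Data.Vec using (tabulate; allFin; toList)
  open import Data.Vec.Properties using (≡-dec; lookup-replicate)
  open import Data.List using ([]; _∷_; foldr)
  open import Data.List.Relation.Unary.Any using (here; there)
  open import Data.List.Membership.Propositional using () renaming (_∈_ to _∈ˡ_)
  open import Data.Product using (Σ; _×_; _,_; proj₁; proj₂)
  open import Data.Sum using (_⊎_; inj₁; inj₂)
  open import Data.Empty using (⊥-elim)
  open import Relation.Nullary using (¬_; yes; no)
  open import Relation.Binary using (tri<; tri≈; tri>)
  open import Relation.Binary.PropositionalEquality hiding ([_])
  import Data.Bool.Properties as Bool

  open Graph G

  src dst : Fin m → Fin n
  src e = proj₁ (ends e)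
  dst e = proj₂ (ends e)

  data Path (X : Subset m) (v : Fin n) : Fin n → Set where
    here     : Path X v v
    forward  : ∀ e → X ! e ≡ true → Path X v (src e) → Path X v (dst e)
    backward : ∀ e → X ! e ≡ true → Path X v (dst e) → Path X v (src e)

  Path-trans : ∀ {X u v w} → Path X u v → Path X v w → Path X u w
  Path-trans p here             = p
  Path-trans p (forward e x q)  = forward e x (Path-trans p q)
  Path-trans p (backward e x q) = backward e x (Path-trans p q)

  Path-sym : ∀ {X u v} → Path X u v → Path X v u
  Path-sym here             = here
  Path-sym (forward e x q)  = Path-trans (backward e x here) (Path-sym q)
  Path-sym (backward e x q) = Path-trans (forward e x here) (Path-sym q)

  Path-mono : ∀ {X Y u v} → X ⊆ Y → Path X u v → Path Y u v
  Path-mono h here             = here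
  Path-mono h (forward e x q)  = forward e (app h e x) (Path-mono h q)
  Path-mono h (backward e x q) = backward e (app h e x) (Path-mono h q)

  path-induction : ∀ Y v (Q : Fin n → Set) → Q v
                 → (∀ e → Y ! e ≡ true → Q (src e) → Q (dst e))
                 → (∀ e → Y ! e ≡ true → Q (dst e) → Q (src e))
                 → ∀ {u} → Path Y v u → Q u
  path-induction Y v Q q₀ f b here             = q₀
  path-induction Y v Q q₀ f b (forward e x p)  = f e x (path-induction Y v Q q₀ f b p)
  path-induction Y v Q q₀ f b (backward e x p) = b e x (path-induction Y v Q q₀ f b p)

  -- `step X` of Defs is the fold of `extend X e` over all edges e.
  spread : Subset n → Fin n → Fin n → Subset n
  spread T a b = (if T ! a then T ∪ ⁅ b ⁆ else T) ∪ (if T ! b then ⁅ a ⁆ else T)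

  extend : Subset m → Fin m → Subset n → Subset n
  extend X e T = if X ! e then spread T (src e) (dst e) else T

  spread-elim : ∀ T a b u → spread T a b ! u ≡ true
              → T ! u ≡ true ⊎ (T ! a ≡ true × b ≡ u) ⊎ (T ! b ≡ true × a ≡ u)
  spread-elim T a b u h with T ! a | T ! b | ∪e (if T ! a then T ∪ ⁅ b ⁆ else T) _ h
  ... | true  | _     | inj₁ q with ∪e T ⁅ b ⁆ q
  ...   | inj₁ t = inj₁ t
  ...   | inj₂ t = inj₂ (inj₁ (refl , !⁅⁆⇒≡ b u t))
  spread-elim T a b u h | false | _     | inj₁ q = inj₁ q
  spread-elim T a b u h | _     | true  | inj₂ q = inj₂ (inj₂ (refl , !⁅⁆⇒≡ a u q))
  spread-elim T a b u h | _     | false | inj₂ q = inj₁ q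

  spread-⊇ : ∀ T a b → T ⊆ spread T a b
  spread-⊇ T a b = sub λ u h → ∪l (if T ! a then T ∪ ⁅ b ⁆ else T) (if T ! b then ⁅ a ⁆ else T) (left u h)
    where
    left : ∀ u → T ! u ≡ true → (if T ! a then T ∪ ⁅ b ⁆ else T) ! u ≡ true
    left u h with T ! a
    ... | true  = ∪l T ⁅ b ⁆ h
    ... | false = h

  spread-a : ∀ T a b → T ! a ≡ true → spread T a b ! b ≡ true
  spread-a T a b h rewrite h = ∪l (T ∪ ⁅ b ⁆) (if T ! b then ⁅ a ⁆ else T) (∪⁅⁆-new T b)

  spread-b : ∀ T a b → T ! b ≡ true → spread T a b ! a ≡ true
  spread-b T a b h rewrite h = ∪r (if T ! a then T ∪ ⁅ b ⁆ else T) ⁅ a ⁆ (!⁅⁆-same a)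

  extend-elim : ∀ X e T u → extend X e T ! u ≡ true
              → T ! u ≡ true ⊎ (X ! e ≡ true × T ! src e ≡ true × dst e ≡ u) ⊎ (X ! e ≡ true × T ! dst e ≡ true × src e ≡ u)
  extend-elim X e T u h with X ! e
  ... | false = inj₁ h
  ... | true with spread-elim T (src e) (dst e) u h
  ...   | inj₁ q            = inj₁ q
  ...   | inj₂ (inj₁ (a , b)) = inj₂ (inj₁ (refl , a , b))
  ...   | inj₂ (inj₂ (a , b)) = inj₂ (inj₂ (refl , a , b))

  extend-⊇ : ∀ X e T → T ⊆ extend X e T
  extend-⊇ X e T with X ! e
  ... | true  = spread-⊇ T (src e) (dst e)
  ... | false = ⊆-refl

  extend-src : ∀ X e T → X ! e ≡ true → T ! src e ≡ true → extend X e T ! dst e ≡ true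
  extend-src X e T x h rewrite x = spread-a T (src e) (dst e) h

  extend-dst : ∀ X e T → X ! e ≡ true → T ! dst e ≡ true → extend X e T ! src e ≡ true
  extend-dst X e T x h rewrite x = spread-b T (src e) (dst e) h

  Closed : Subset m → Subset n → Set
  Closed X S = ∀ e → X ! e ≡ true → (S ! src e ≡ true → S ! dst e ≡ true) × (S ! dst e ≡ true → S ! src e ≡ true)

  extend-closed : ∀ X e S → Closed X S → extend X e S ≡ S
  extend-closed X e S closed = ⊆-antisym (sub f) (extend-⊇ X e S)
    where
    f : ∀ u → extend X e S ! u ≡ true → S ! u ≡ true
    f u h with extend-elim X e S u h
    ... | inj₁ q                       = q
    ... | inj₂ (inj₁ (x , a , refl)) = proj₁ (closed e x) a
    ... | inj₂ (inj₂ (x , a , refl)) = proj₂ (closed e x) a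

  fold-⊇ : ∀ X S es → S ⊆ foldr (extend X) S es
  fold-⊇ X S []       = ⊆-refl
  fold-⊇ X S (e ∷ es) = ⊆-trans (fold-⊇ X S es) (extend-⊇ X e (foldr (extend X) S es))

  fold-sound : ∀ X S (Q : Fin n → Set) es
             → (∀ u → S ! u ≡ true → Q u)
             → (∀ e → X ! e ≡ true → Q (src e) → Q (dst e))
             → (∀ e → X ! e ≡ true → Q (dst e) → Q (src e))
             → ∀ u → foldr (extend X) S es ! u ≡ true → Q u
  fold-sound X S Q []       q₀ f b u q = q₀ u q
  fold-sound X S Q (e ∷ es) q₀ f b u q with extend-elim X e (foldr (extend X) S es) u q
  ... | inj₁ t                       = fold-sound X S Q es q₀ f b u t
  ... | inj₂ (inj₁ (x , a , refl)) = f e x (fold-sound X S Q es q₀ f b (src e) a)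
  ... | inj₂ (inj₂ (x , a , refl)) = b e x (fold-sound X S Q es q₀ f b (dst e) a)

  fold-fixed : ∀ X S es → foldr (extend X) S es ≡ S → ∀ e → e ∈ˡ es → extend X e S ≡ S
  fold-fixed X S (e′ ∷ es) eq e e∈ = go e∈
    where
    T = foldr (extend X) S es
    T≡S : T ≡ S
    T≡S = ⊆-antisym (⊆-trans (extend-⊇ X e′ T) (sub λ i q → subst (λ U → U ! i ≡ true) eq q)) (fold-⊇ X S es)
    go : e ∈ˡ e′ ∷ es → extend X e S ≡ S
    go (here refl) = trans (cong (extend X e′) (sym T≡S)) eq
    go (there e∈′) = fold-fixed X S es T≡S e e∈′

  fold-closed : ∀ X S es → Closed X S → foldr (extend X) S es ≡ S
  fold-closed X S []       closed = refl
  fold-closed X S (e ∷ es) closed = trans (cong (extend X e) (fold-closed X S es closed)) (extend-closed X e S closed)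

  step-fixed⇒closed : ∀ X S → step G X S ≡ S → Closed X S
  step-fixed⇒closed X S eq e x =
      (λ h → subst (λ U → U ! dst e ≡ true) fixed (extend-src X e S x h))
    , (λ h → subst (λ U → U ! src e ≡ true) fixed (extend-dst X e S x h))
    where
    fixed : extend X e S ≡ S
    fixed = fold-fixed X S (toList (allFin m)) eq e (∈-allFin e)

  -- Until the iteration stabilises it gains a vertex per round, so n rounds reach a closed set.
  iter-closed-or-grows : ∀ X v k → Closed X (iter G k X ⁅ v ⁆) ⊎ suc k ≤ ∣ iter G k X ⁅ v ⁆ ∣
  iter-closed-or-grows X v zero = inj₂ (≤-reflexive (sym (∣⁅x⁆∣≡1 v)))
  iter-closed-or-grows X v (suc k) with iter-closed-or-grows X v k
  ... | inj₁ closed = inj₁ (subst (Closed X) (sym (fold-closed X _ (toList (allFin m)) closed)) closed)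
  ... | inj₂ grows with ≡-dec Bool._≟_ (step G X (iter G k X ⁅ v ⁆)) (iter G k X ⁅ v ⁆)
  ...   | yes eq = inj₁ (subst (Closed X) (sym eq) (step-fixed⇒closed X _ eq))
  ...   | no ne  = inj₂ (<-≤-trans (s≤s grows) (⊂⇒∣∣< _ _ (fold-⊇ X _ (toList (allFin m))) λ eq → ne (sym eq)))

  reach-closed : ∀ X v → Closed X (reach G X v)
  reach-closed X v with iter-closed-or-grows X v n
  ... | inj₁ closed = closed
  ... | inj₂ grows  = ⊥-elim (<-irrefl refl (<-≤-trans grows (∣p∣≤n (iter G n X ⁅ v ⁆))))

  iter-⊇ : ∀ X S k → S ⊆ iter G k X S
  iter-⊇ X S zero    = ⊆-refl
  iter-⊇ X S (suc k) = ⊆-trans (iter-⊇ X S k) (fold-⊇ X _ (toList (allFin m)))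

  iter-sound : ∀ X v k u → iter G k X ⁅ v ⁆ ! u ≡ true → Path X v u
  iter-sound X v zero u q with !⁅⁆⇒≡ v u q
  ... | refl = here
  iter-sound X v (suc k) u q =
    fold-sound X (iter G k X ⁅ v ⁆) (Path X v) (toList (allFin m)) (iter-sound X v k) forward backward u q

  closed-path : ∀ X S v u → Closed X S → S ! v ≡ true → Path X v u → S ! u ≡ true
  closed-path X S v u closed sv here             = sv
  closed-path X S v u closed sv (forward e x p)  = proj₁ (closed e x) (closed-path X S v _ closed sv p)
  closed-path X S v u closed sv (backward e x p) = proj₂ (closed e x) (closed-path X S v _ closed sv p)

  reach-sound : ∀ X v u → reach G X v ! u ≡ true → Path X v u
  reach-sound X v u = iter-sound X v n u

  reach-complete : ∀ X v u → Path X v u → reach G X v ! u ≡ true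
  reach-complete X v u p = closed-path X (reach G X v) v u (reach-closed X v) (app (iter-⊇ X ⁅ v ⁆ n) v (!⁅⁆-same v)) p

  isRep-sound : ∀ X v → isRep G X v ≡ true → ∀ u → Path X v u → toℕ v ≤ toℕ u
  isRep-sound X v h u p with ∨-elim (allFin⇒ (λ u → not (reach G X v ! u) ∨ (toℕ v ≤ᵇ toℕ u)) h u)
  ... | inj₂ q = ≤ᵇ-sound q
  ... | inj₁ q = ⊥-elim (true≢false (trans (sym (reach-complete X v u p)) (not-elim q)))

  isRep-complete : ∀ X v → (∀ u → Path X v u → toℕ v ≤ toℕ u) → isRep G X v ≡ true
  isRep-complete X v h = allFin⇐ (λ u → not (reach G X v ! u) ∨ (toℕ v ≤ᵇ toℕ u)) f
    where
    f : ∀ u → not (reach G X v ! u) ∨ (toℕ v ≤ᵇ toℕ u) ≡ true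
    f u with true⊎false (reach G X v ! u)
    ... | inj₁ q = ∨-introʳ {not (reach G X v ! u)} (≤ᵇ-complete (h u (reach-sound X v u q)))
    ... | inj₂ q = ∨-introˡ (not-intro q)

  least : ∀ {k} (p : Fin k → Bool) a → p a ≡ true → Σ (Fin k) λ w → p w ≡ true × (∀ u → p u ≡ true → toℕ w ≤ toℕ u)
  least p zero    pa = zero , pa , λ _ _ → z≤n
  least p (suc a) pa with true⊎false (p zero)
  ... | inj₁ p0 = zero , p0 , λ _ _ → z≤n
  ... | inj₂ p0 with least (λ u → p (suc u)) a pa
  ...   | w , pw , min = suc w , pw , λ { zero q → ⊥-elim (true≢false (trans (sym q) p0)) ; (suc u) q → s≤s (min u q) }

  least-reachable : ∀ X a → Σ (Fin n) λ w → Path X a w × (∀ u → Path X a u → toℕ w ≤ toℕ u)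
  least-reachable X a with least (λ u → reach G X a ! u) a (reach-complete X a a here)
  ... | w , pw , min = w , reach-sound X a w pw , λ u p → min u (reach-complete X a u p)

  rep-unique : ∀ X r w → Path X r w → (∀ u → Path X r u → toℕ w ≤ toℕ u)
             → ∀ i → isRep G X i ≡ true → Path X i r → i ≡ w
  rep-unique X r w pw min i rep pi =
    toℕ-injective (≤-antisym (isRep-sound X i rep w (Path-trans pi pw)) (min i (Path-sym pi)))

  module AddEdge (X : Subset m) (e₀ : Fin m) where
    a = src e₀
    b = dst e₀
    Y = X ∪ ⁅ e₀ ⁆

    ViaEdge : Fin n → Fin n → Set
    ViaEdge v u = Path X v u ⊎ (Path X v a × Path X b u) ⊎ (Path X v b × Path X a u)

    X⊆Y : X ⊆ Y
    X⊆Y = ⊆∪l X ⁅ e₀ ⁆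

    Y-e₀ : Y ! e₀ ≡ true
    Y-e₀ = ∪⁅⁆-new X e₀

    path-via-edge : ∀ v u → Path Y v u → ViaEdge v u
    path-via-edge v u p = path-induction Y v (ViaEdge v) (inj₁ here) forward-step backward-step p
      where
      forward-step : ∀ e → Y ! e ≡ true → ViaEdge v (src e) → ViaEdge v (dst e)
      forward-step e y φ with ∪⁅⁆-elim X e₀ e y
      forward-step e y (inj₁ p₁)              | inj₁ x    = inj₁ (forward e x p₁)
      forward-step e y (inj₂ (inj₁ (p₁ , p₂))) | inj₁ x    = inj₂ (inj₁ (p₁ , forward e x p₂))
      forward-step e y (inj₂ (inj₂ (p₁ , p₂))) | inj₁ x    = inj₂ (inj₂ (p₁ , forward e x p₂))
      forward-step e y (inj₁ p₁)              | inj₂ refl = inj₂ (inj₁ (p₁ , here))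
      forward-step e y (inj₂ (inj₁ (p₁ , p₂))) | inj₂ refl = inj₂ (inj₁ (p₁ , here))
      forward-step e y (inj₂ (inj₂ (p₁ , p₂))) | inj₂ refl = inj₁ p₁
      backward-step : ∀ e → Y ! e ≡ true → ViaEdge v (dst e) → ViaEdge v (src e)
      backward-step e y φ with ∪⁅⁆-elim X e₀ e y
      backward-step e y (inj₁ p₁)              | inj₁ x    = inj₁ (backward e x p₁)
      backward-step e y (inj₂ (inj₁ (p₁ , p₂))) | inj₁ x    = inj₂ (inj₁ (p₁ , backward e x p₂))
      backward-step e y (inj₂ (inj₂ (p₁ , p₂))) | inj₁ x    = inj₂ (inj₂ (p₁ , backward e x p₂))
      backward-step e y (inj₁ p₁)              | inj₂ refl = inj₂ (inj₂ (p₁ , here))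
      backward-step e y (inj₂ (inj₁ (p₁ , p₂))) | inj₂ refl = inj₁ p₁
      backward-step e y (inj₂ (inj₂ (p₁ , p₂))) | inj₂ refl = inj₂ (inj₂ (p₁ , here))

    path-ab : ∀ v u → Path X v a → Path X b u → Path Y v u
    path-ab v u p₁ p₂ = Path-trans (Path-mono X⊆Y p₁) (Path-trans (forward e₀ Y-e₀ here) (Path-mono X⊆Y p₂))

    path-ba : ∀ v u → Path X v b → Path X a u → Path Y v u
    path-ba v u p₁ p₂ = Path-trans (Path-mono X⊆Y p₁) (Path-trans (backward e₀ Y-e₀ here) (Path-mono X⊆Y p₂))

    components-connected : Path X a b → components G Y ≡ components G X
    components-connected pab = cong ∣_∣ (ext {S = tabulate (isRep G Y)} {T = tabulate (isRep G X)} λ i →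
      trans (!tabulate (isRep G Y) i) (trans (same-rep i) (sym (!tabulate (isRep G X) i))))
      where
      to-X : ∀ v u → Path Y v u → Path X v u
      to-X v u p with path-via-edge v u p
      ... | inj₁ p₁              = p₁
      ... | inj₂ (inj₁ (p₁ , p₂)) = Path-trans p₁ (Path-trans pab p₂)
      ... | inj₂ (inj₂ (p₁ , p₂)) = Path-trans p₁ (Path-trans (Path-sym pab) p₂)
      same-rep : ∀ i → isRep G Y i ≡ isRep G X i
      same-rep i = ≡-by-⇔ (λ h → isRep-complete X i λ u p → isRep-sound Y i h u (Path-mono X⊆Y p))
                          (λ h → isRep-complete Y i λ u p → isRep-sound X i h u (to-X i u p))

    -- The edge joins the components of p and q; the larger of their two representatives stops being one.
    components-merge : ∀ (p q : Fin n)
      → (∀ v u → Path Y v u → Path X v u ⊎ (Path X v p × Path X q u) ⊎ (Path X v q × Path X p u))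
      → (∀ v u → Path X v q → Path X p u → Path Y v u)
      → ∀ wp wq → Path X p wp → (∀ u → Path X p u → toℕ wp ≤ toℕ u)
      → Path X q wq → (∀ u → Path X q u → toℕ wq ≤ toℕ u)
      → toℕ wp < toℕ wq
      → components G X ≡ suc (components G Y)
    components-merge p q via join wp wq pp min-p pq min-q wp<wq =
      ∣∣-one-more (tabulate (isRep G Y)) (tabulate (isRep G X)) wq
        (trans (!tabulate (isRep G Y) wq) wq-not-rep) (trans (!tabulate (isRep G X) wq) wq-rep)
        λ i ne → trans (!tabulate (isRep G Y) i) (trans (others i ne) (sym (!tabulate (isRep G X) i)))
      where
      wq-not-rep : isRep G Y wq ≡ false
      wq-not-rep = ≢true⇒≡false λ h → <-irrefl refl (<-≤-trans wp<wq (isRep-sound Y wq h wp (join wq wp (Path-sym pq) pp)))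
      wq-rep : isRep G X wq ≡ true
      wq-rep = isRep-complete X wq λ u p′ → min-q u (Path-trans pq p′)
      others : ∀ i → i ≢ wq → isRep G Y i ≡ isRep G X i
      others i ne = ≡-by-⇔ (λ h → isRep-complete X i λ u p′ → isRep-sound Y i h u (Path-mono X⊆Y p′)) still-rep
        where
        still-rep : isRep G X i ≡ true → isRep G Y i ≡ true
        still-rep h = isRep-complete Y i f
          where
          f : ∀ u → Path Y i u → toℕ i ≤ toℕ u
          f u p′ with via i u p′
          ... | inj₁ p₁ = isRep-sound X i h u p₁
          ... | inj₂ (inj₁ (p₁ , p₂)) with rep-unique X p wp pp min-p i h p₁
          ...   | refl = ≤-trans (<⇒≤ wp<wq) (min-q u p₂)
          f u p′ | inj₂ (inj₂ (p₁ , p₂)) = ⊥-elim (ne (rep-unique X q wq pq min-q i h p₁))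

    components-separated : ¬ Path X a b → components G X ≡ suc (components G Y)
    components-separated ¬pab with least-reachable X a | least-reachable X b
    ... | wa , pa , min-a | wb , pb , min-b with <-cmp (toℕ wa) (toℕ wb)
    ...   | tri< lt _ _ = components-merge a b path-via-edge path-ba wa wb pa min-a pb min-b lt
    ...   | tri≈ _ eq _ = ⊥-elim (¬pab (Path-trans pa (Path-sym (subst (Path X b) (sym (toℕ-injective eq)) pb))))
    ...   | tri> _ _ gt = components-merge b a swapped path-ab wb wa pb min-b pa min-a gt
      where
      swapped : ∀ v u → Path Y v u → Path X v u ⊎ (Path X v b × Path X a u) ⊎ (Path X v a × Path X b u)
      swapped v u p with path-via-edge v u p
      ... | inj₁ p₁       = inj₁ p₁
      ... | inj₂ (inj₁ z) = inj₂ (inj₂ z)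
      ... | inj₂ (inj₂ z) = inj₂ (inj₁ z)

  components≤n : ∀ X → components G X ≤ n
  components≤n X = ∣p∣≤n (tabulate (isRep G X))

  path? : ∀ X u v → Path X u v ⊎ ¬ Path X u v
  path? X u v with true⊎false (reach G X u ! v)
  ... | inj₁ q = inj₁ (reach-sound X u v q)
  ... | inj₂ q = inj₂ λ p → true≢false (trans (sym (reach-complete X u v p)) q)

  rank-connected : ∀ X e → Path X (src e) (dst e) → rank G (X ∪ ⁅ e ⁆) ≡ rank G X
  rank-connected X e p = cong (n ∸_) (AddEdge.components-connected X e p)

  rank-separated : ∀ X e → ¬ Path X (src e) (dst e) → rank G (X ∪ ⁅ e ⁆) ≡ suc (rank G X)
  rank-separated X e ¬p = begin
    n ∸ components G (X ∪ ⁅ e ⁆)           ≡⟨⟩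
    suc n ∸ suc (components G (X ∪ ⁅ e ⁆)) ≡⟨ cong (suc n ∸_) (sym (AddEdge.components-separated X e ¬p)) ⟩
    suc n ∸ components G X                 ≡⟨ +-∸-assoc 1 (components≤n X) ⟩
    suc (n ∸ components G X)               ∎
    where open ≡-Reasoning

  rank-unit : ∀ X e → X ! e ≡ false → rank G (X ∪ ⁅ e ⁆) ≡ rank G X ⊎ rank G (X ∪ ⁅ e ⁆) ≡ suc (rank G X)
  rank-unit X e _ with path? X (src e) (dst e)
  ... | inj₁ p  = inj₁ (rank-connected X e p)
  ... | inj₂ ¬p = inj₂ (rank-separated X e ¬p)

  rank-closure : ∀ X Z e → X ⊆ Z → rank G (X ∪ ⁅ e ⁆) ≡ rank G X → rank G (Z ∪ ⁅ e ⁆) ≡ rank G Z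
  rank-closure X Z e X⊆Z eq with path? X (src e) (dst e)
  ... | inj₁ p  = rank-connected Z e (Path-mono X⊆Z p)
  ... | inj₂ ¬p = ⊥-elim (1+n≢n (trans (sym (rank-separated X e ¬p)) eq))

  rank-empty : rank G ⊥ ≡ 0
  rank-empty = trans (cong (n ∸_) components-⊥) (n∸n≡0 n)
    where
    no-path : ∀ v u → Path ⊥ v u → v ≡ u
    no-path v u here             = refl
    no-path v u (forward e x p)  = ⊥-elim (true≢false (trans (sym x) (!⊥ e)))
    no-path v u (backward e x p) = ⊥-elim (true≢false (trans (sym x) (!⊥ e)))
    components-⊥ : components G ⊥ ≡ n
    components-⊥ = trans (cong ∣_∣ (ext {S = tabulate (isRep G ⊥)} {T = ⊤} λ i → trans (!tabulate (isRep G ⊥) i)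
      (trans (isRep-complete ⊥ i λ u p → ≤-reflexive (cong toℕ (no-path i u p))) (sym (lookup-replicate i true)))))
      (∣⊤∣≡n n)

  rank-axioms : RankAxioms (rank G)
  rank-axioms = record { r-empty = rank-empty ; r-unit = rank-unit ; r-closure = rank-closure }

  rank≤n : ∀ X → rank G X ≤ n
  rank≤n X = m∸n≤m n (components G X)

  components≡n∸rank : ∀ X → components G X ≡ n ∸ rank G X
  components≡n∸rank X = sym (m∸[m∸n]≡n (components≤n X))

module LabelledGraph (G : Graph) (A : Subset (Graph.m G)) (φ : Fin (Graph.m G) → ℤ) (proper : ProperLabeling G A φ) where
  open import Defs
    using (Graph; ProperLabeling; smallestIn; isCycle; isCocycle; containsCycle; containsCocycle;
           compl; isContracting; internallyActive; externallyActive; components; rank; rankM; rankContracted; subsetsOf)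
  open import Data.Bool using (Bool; true; false; _∧_; _∨_; not)
  open import Data.Bool.Properties using (not-involutive)
  open import Data.Nat using (ℕ; _+_; _∸_; _≤_; _<_; _<ᵇ_; s≤s)
  open import Data.Nat.Properties
  open import Data.Integer as ℤ using (ℤ; +_; 0ℤ)
  open import Data.Fin using (Fin)
  open import Data.Fin.Properties using () renaming (_≟_ to _≟F_)
  open import Data.Fin.Subset using (Subset; ⁅_⁆; _∪_; _∩_; ∁; _─_; _-_; ∣_∣)
  import Data.Fin.Subset as Subset
  open import Data.Vec.Properties using ([]=⇒lookup)
  open import Data.Product using (_×_; _,_; proj₁; proj₂)
  open import Data.Sum using (_⊎_; inj₁; inj₂)
  open import Data.Empty using (⊥-elim) renaming (⊥ to Empty)
  open import Relation.Nullary using (¬_; yes; no)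
  open import Relation.Binary using (tri<; tri≈; tri>)
  open import Relation.Binary.PropositionalEquality hiding ([_])

  open Graph G using (n; m)
  open GraphRank G

  r : Subset m → ℕ
  r = rank G

  label : Fin m → ℕ
  label g = ℤ.∣ φ g ∣

  ∉A⇒φ≡+label : ∀ {e} → A ! e ≡ false → φ e ≡ + label e
  ∉A⇒φ≡+label {e} a = positive (proj₁ (proj₂ proper) e ∉A)
    where
    ∉A : ¬ (e Subset.∈ A)
    ∉A h = true≢false (trans (sym ([]=⇒lookup h)) a)
    positive : ∀ {i} → 0ℤ ℤ.< i → i ≡ + ℤ.∣ i ∣
    positive {+ _} _ = refl

  label-injective : ∀ g h → A ! g ≡ false → A ! h ≡ false → label g ≡ label h → g ≡ h
  label-injective g h ag ah eq =
    proj₂ (proj₂ proper) g h (∉ ag) (∉ ah) (trans (∉A⇒φ≡+label ag) (trans (cong +_ eq) (sym (∉A⇒φ≡+label ah))))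
    where
    ∉ : ∀ {e} → A ! e ≡ false → ¬ (e Subset.∈ A)
    ∉ a h = true≢false (trans (sym ([]=⇒lookup h)) a)

  open Activities rank-axioms A label label-injective public

  smallestIn-sound : ∀ e S g → smallestIn G φ e S ≡ true → S ! g ≡ true → A ! e ≡ false → A ! g ≡ false → label e ≤ label g
  smallestIn-sound e S g h sg ae ag with ∨-elim (allFin⇒ (λ g → not (S ! g) ∨ (φ e ℤ.≤ᵇ φ g)) h g)
  ... | inj₁ q = ⊥-elim (true≢false (trans (sym sg) (not-elim q)))
  ... | inj₂ q = ≤ᵇ-sound (subst₂ (λ x y → (x ℤ.≤ᵇ y) ≡ true) (∉A⇒φ≡+label ae) (∉A⇒φ≡+label ag) q)

  smallestIn-complete : ∀ e S → A ! e ≡ false → (∀ g → S ! g ≡ true → A ! g ≡ false × label e ≤ label g)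
                      → smallestIn G φ e S ≡ true
  smallestIn-complete e S ae h = allFin⇐ (λ g → not (S ! g) ∨ (φ e ℤ.≤ᵇ φ g)) f
    where
    f : ∀ g → not (S ! g) ∨ (φ e ℤ.≤ᵇ φ g) ≡ true
    f g with true⊎false (S ! g)
    ... | inj₂ q = ∨-introˡ (not-intro q)
    ... | inj₁ q = let ag , le = h g q in ∨-introʳ {not (S ! g)}
      (subst₂ (λ x y → (x ℤ.≤ᵇ y) ≡ true) (sym (∉A⇒φ≡+label ae)) (sym (∉A⇒φ≡+label ag)) (≤ᵇ-complete le))

  isCycleP isCocycleP : Subset m → Bool
  isCycleP   S = r S <ᵇ ∣ S ∣
  isCocycleP S = components G Ground <ᵇ components G (Ground ─ S)

  -- Removing edges raises the number of components exactly when it lowers the rank.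
  isCocycleP-sound : ∀ S → isCocycleP S ≡ true → r (Ground ─ S) < r Ground
  isCocycleP-sound S h with <-cmp (r (Ground ─ S)) (r Ground)
  ... | tri< lt _ _ = lt
  ... | tri≈ _ eq _ = ⊥-elim (<-irrefl (trans (components≡n∸rank Ground)
                        (trans (cong (n ∸_) (sym eq)) (sym (components≡n∸rank (Ground ─ S))))) (<ᵇ-sound h))
  ... | tri> _ _ gt = ⊥-elim (<-asym (<ᵇ-sound h) (subst₂ _<_ (sym (components≡n∸rank (Ground ─ S)))
                        (sym (components≡n∸rank Ground)) (∸-monoʳ-< gt (rank≤n (Ground ─ S)))))

  isCocycleP-complete : ∀ S → r (Ground ─ S) < r Ground → isCocycleP S ≡ true
  isCocycleP-complete S lt = <ᵇ-complete (subst₂ _<_ (sym (components≡n∸rank Ground))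
    (sym (components≡n∸rank (Ground ─ S))) (∸-monoʳ-< lt (rank≤n Ground)))

  Ground─⊆ : ∀ {S D} → S ⊆ D → Ground ─ D ⊆ Ground ─ S
  Ground─⊆ {S} {D} h = sub λ i q → let g , d = ─e Ground D q in
    ─i Ground S g (≢true⇒≡false λ s → true≢false (trans (sym (app h i s)) d))

  Ground─Ground─ : ∀ W → Ground ─ (Ground ─ W) ≡ W
  Ground─Ground─ W = ext λ i → trans (!─ Ground (Ground ─ W) i) (trans (cong (λ z → Ground ! i ∧ not z) (!─ Ground W i))
    (trans (cong (λ z → z ∧ not (z ∧ not (W ! i))) (!tabulate (λ _ → true) i)) (not-involutive _)))

  Ground─compl : ∀ C → Ground ─ compl G A C ≡ C ∪ A
  Ground─compl C = ext λ i → trans (!─ Ground (compl G A C) i) (trans (cong (λ z → Ground ! i ∧ not z) (!∁ (C ∪ A) i))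
    (trans (cong (λ z → z ∧ not (not ((C ∪ A) ! i))) (!tabulate (λ _ → true) i)) (not-involutive _)))

  independent⇔no-cycle : ∀ C → (containsCycle G C ≡ false → Independent C) × (Independent C → containsCycle G C ≡ false)
  independent⇔no-cycle C = to , from
    where
    to : containsCycle G C ≡ false → Independent C
    to h with <-cmp (r C) ∣ C ∣
    ... | tri≈ _ eq _ = eq
    ... | tri> _ _ gt = ⊥-elim (<-irrefl refl (<-≤-trans gt (r≤∣∣ C)))
    ... | tri< lt _ _ with minimal-below isCycleP C (<ᵇ-complete lt)
    ...   | T , T⊆C , minimal = ⊥-elim (true≢false
            (trans (sym (any⇐ (isCycle G) (subsetsOf C) (subsetsOf⇐ C T T⊆C) minimal)) h))
    from : Independent C → containsCycle G C ≡ false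
    from indep = ≢true⇒≡false λ h → let S , S∈ , cycle = any⇒ (isCycle G) (subsetsOf C) h in
      <-irrefl (independent-⊆ indep (subsetsOf⇒ C S S∈)) (<ᵇ-sound (proj₁ (minimalᵇ⇒ isCycleP S cycle)))

  spanning⇔no-cocycle : ∀ D → (containsCocycle G D ≡ false → r (Ground ─ D) ≡ r Ground)
                              × (r (Ground ─ D) ≡ r Ground → containsCocycle G D ≡ false)
  spanning⇔no-cocycle D = to , from
    where
    to : containsCocycle G D ≡ false → r (Ground ─ D) ≡ r Ground
    to h with <-cmp (r (Ground ─ D)) (r Ground)
    ... | tri≈ _ eq _ = eq
    ... | tri> _ _ gt = ⊥-elim (<-irrefl refl (<-≤-trans gt (r≤r-Ground (Ground ─ D))))
    ... | tri< lt _ _ with minimal-below isCocycleP D (isCocycleP-complete D lt)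
    ...   | T , T⊆D , minimal = ⊥-elim (true≢false
            (trans (sym (any⇐ (isCocycle G) (subsetsOf D) (subsetsOf⇐ D T T⊆D) minimal)) h))
    from : r (Ground ─ D) ≡ r Ground → containsCocycle G D ≡ false
    from span = ≢true⇒≡false λ h → let S , S∈ , cocycle = any⇒ (isCocycle G) (subsetsOf D) h in
      <-irrefl refl (<-≤-trans (isCocycleP-sound S (proj₁ (minimalᵇ⇒ isCocycleP S cocycle)))
        (≤-trans (≤-reflexive (sym span)) (r-mono (Ground─⊆ (subsetsOf⇒ D S S∈)))))

  contracting-sound : ∀ C → isContracting G A C ≡ true → Contracting C
  contracting-sound C h with ∧-elim h
  ... | C⊆ , h′ with ∧-elim h′
  ...   | no-cycle , no-cocycle = contracting (subsetᵇ⇒ C (∁ A) C⊆) (proj₁ (independent⇔no-cycle C) (not-elim no-cycle))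
            (trans (cong r (sym (Ground─compl C))) (proj₁ (spanning⇔no-cocycle (compl G A C)) (not-elim no-cocycle)))

  contracting-complete : ∀ C → Contracting C → isContracting G A C ≡ true
  contracting-complete C (contracting C⊆ indep span) = ∧-intro (subsetᵇ⇐ C (∁ A) C⊆)
    (∧-intro (not-intro (proj₂ (independent⇔no-cycle C) indep))
             (not-intro (proj₂ (spanning⇔no-cocycle (compl G A C)) (trans (cong r (Ground─compl C)) span))))

  compl-elim : ∀ C i → compl G A C ! i ≡ true → C ! i ≡ false × A ! i ≡ false
  compl-elim C i q with true⊎false (C ! i) | true⊎false (A ! i)
  ... | inj₁ c | _      = ⊥-elim (true≢false (trans (sym (∪l C A c)) (∁e (C ∪ A) q)))
  ... | inj₂ c | inj₁ a = ⊥-elim (true≢false (trans (sym (∪r C A a)) (∁e (C ∪ A) q)))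
  ... | inj₂ c | inj₂ a = c , a

  compl-intro : ∀ C i → C ! i ≡ false → A ! i ≡ false → compl G A C ! i ≡ true
  compl-intro C i c a = ∁i (C ∪ A) (trans (!∪ C A i) (cong₂ _∨_ c a))

  internallyActive-sound : ∀ C e → Contracting C → C ! e ≡ true → internallyActive G A φ C e ≡ true → InternallyActive C e
  internallyActive-sound C e cC ce h
    with any⇒ (λ S → isCocycle G S ∧ S ! e ∧ smallestIn G φ e S) (subsetsOf (compl G A C ∪ ⁅ e ⁆)) h
  ... | S , S∈ , q with ∧-elim q
  ...   | cocycle , q′ with ∧-elim q′
  ...     | e∈S , smallest =
    ≤-<-trans (r-mono (sub avoids)) (isCocycleP-sound S (proj₁ (minimalᵇ⇒ isCocycleP S cocycle)))
    where
    ae = ∉A (Contracting.⊆∁A cC) ce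
    in-D∪e : ∀ i → S ! i ≡ true → (C ! i ≡ false × A ! i ≡ false) ⊎ e ≡ i
    in-D∪e i s with ∪⁅⁆-elim (compl G A C) e i (app (subsetsOf⇒ (compl G A C ∪ ⁅ e ⁆) S S∈) i s)
    ... | inj₁ d  = inj₁ (compl-elim C i d)
    ... | inj₂ eq = inj₂ eq
    avoids : ∀ i → outsideCut C e ! i ≡ true → (Ground ─ S) ! i ≡ true
    avoids i w = ─i Ground S (!tabulate (λ _ → true) i) (≢true⇒≡false ∉S)
      where
      ∉S : S ! i ≡ true → Empty
      ∉S s with ∪e ((C - e) ∪ A) (below e) w
      ... | inj₂ l = let ai , lt = below-elim l in <-irrefl refl (<-≤-trans lt (smallestIn-sound e S i smallest s ae ai))
      ... | inj₁ ca with ∪e (C - e) A ca | in-D∪e i s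
      ...   | inj₁ c | inj₁ (c′ , _) = true≢false (trans (sym (proj₁ (-elim C c))) c′)
      ...   | inj₁ c | inj₂ eq      = proj₂ (-elim C c) eq
      ...   | inj₂ a | inj₁ (_ , a′) = true≢false (trans (sym a) a′)
      ...   | inj₂ a | inj₂ refl    = true≢false (trans (sym a) ae)

  internallyActive-complete : ∀ C e → Contracting C → C ! e ≡ true → InternallyActive C e → internallyActive G A φ C e ≡ true
  internallyActive-complete C e cC ce active
    with minimal-below isCocycleP (Ground ─ outsideCut C e)
           (isCocycleP-complete _ (subst (λ W → r W < r Ground) (sym (Ground─Ground─ (outsideCut C e))) active))
  ... | S , S⊆ , minimal = any⇐ (λ S → isCocycle G S ∧ S ! e ∧ smallestIn G φ e S) (subsetsOf D∪e)
                             (subsetsOf⇐ D∪e S (sub S⊆D∪e)) (∧-intro minimal (∧-intro e∈S (smallestIn-complete e S ae smallest)))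
    where
    open Contracting cC
    ae = ∉A ⊆∁A ce
    D∪e = compl G A C ∪ ⁅ e ⁆
    ∉W : ∀ i → S ! i ≡ true → outsideCut C e ! i ≡ false
    ∉W i s = proj₂ (─e Ground (outsideCut C e) (app S⊆ i s))
    S∉A : ∀ i → S ! i ≡ true → A ! i ≡ false
    S∉A i s = ≢true⇒≡false λ a → true≢false (trans (sym (∪l ((C - e) ∪ A) (below e) (∪r (C - e) A a))) (∉W i s))
    S∉C : ∀ i → S ! i ≡ true → e ≢ i → C ! i ≡ false
    S∉C i s ne = ≢true⇒≡false λ c → true≢false (trans (sym (∪l ((C - e) ∪ A) (below e) (∪l (C - e) A (-intro C c ne)))) (∉W i s))
    S⊆D∪e : ∀ i → S ! i ≡ true → D∪e ! i ≡ true
    S⊆D∪e i s with e ≟F i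
    ... | yes refl = ∪⁅⁆-new (compl G A C) e
    ... | no ne    = ∪l (compl G A C) ⁅ e ⁆ (compl-intro C i (S∉C i s ne) (S∉A i s))
    -- Otherwise S ⊆ D, and removing S from E would not lower the rank, as C ∪ A ⊆ E ─ D spans.
    e∈S : S ! e ≡ true
    e∈S = ≢false⇒≡true λ e∉S → <-irrefl refl (<-≤-trans (isCocycleP-sound S (proj₁ (minimalᵇ⇒ isCocycleP S minimal)))
      (≤-trans (≤-reflexive (sym spanning)) (≤-trans (≤-reflexive (cong r (sym (Ground─compl C))))
        (r-mono (Ground─⊆ (sub λ i s → S⊆D i s e∉S))))))
      where
      S⊆D : ∀ i → S ! i ≡ true → S ! e ≡ false → compl G A C ! i ≡ true
      S⊆D i s e∉S with e ≟F i
      ... | yes refl = ⊥-elim (true≢false (trans (sym s) e∉S))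
      ... | no ne    = compl-intro C i (S∉C i s ne) (S∉A i s)
    smallest : ∀ g → S ! g ≡ true → A ! g ≡ false × label e ≤ label g
    smallest g s = S∉A g s , ≮⇒≥ λ lt → true≢false (trans (sym (∪r ((C - e) ∪ A) (below e) (below-intro (S∉A g s) lt))) (∉W g s))

  externallyActive-sound : ∀ C f → Contracting C → A ! f ≡ false → C ! f ≡ false
                         → externallyActive G A φ C f ≡ true → ExternallyActive C f
  externallyActive-sound C f cC af cf h
    with any⇒ (λ S → isCycle G S ∧ S ! f ∧ smallestIn G φ f S) (subsetsOf (C ∪ ⁅ f ⁆)) h
  ... | S , S∈ , q with ∧-elim q
  ...   | cycle , q′ with ∧-elim q′
  ...     | f∈S , smallest = rank-closure (S - f) (upper C f) f (sub S-f⊆upper) S-f-spans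
    where
    minimal = minimalᵇ⇒ isCycleP S cycle
    in-C : ∀ i → S ! i ≡ true → f ≢ i → C ! i ≡ true
    in-C i s ne with ∪⁅⁆-elim C f i (app (subsetsOf⇒ (C ∪ ⁅ f ⁆) S S∈) i s)
    ... | inj₁ c  = c
    ... | inj₂ eq = ⊥-elim (ne eq)
    S-f⊆upper : ∀ i → (S - f) ! i ≡ true → upper C f ! i ≡ true
    S-f⊆upper i q′ = let s , ne = -elim S q′ ; c = in-C i s ne ; ai = ∉A (Contracting.⊆∁A cC) c in
      ∩i C (above f) c (above-intro ai (≤∧≢⇒< (smallestIn-sound f S i smallest s af ai) λ eq → ne (label-injective f i af ai eq)))
    S-f-independent : ∣ S - f ∣ ≤ r (S - f)
    S-f-independent = ≮⇒≥ (<ᵇ-false (proj₂ minimal (S - f) (-⊆ S f) λ eq → true≢false (trans (sym f∈S) (trans (cong (_! f) (sym eq)) (-self S f)))))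
    -- S is a circuit, so S - f spans f.
    S-f-spans : r ((S - f) ∪ ⁅ f ⁆) ≡ r (S - f)
    S-f-spans = ≤-antisym (begin
      r ((S - f) ∪ ⁅ f ⁆) ≡⟨ cong r (-∪⁅⁆ S f f∈S) ⟩
      r S                 ≤⟨ ≤-pred (subst (r S <_) (∣-∣ S f f∈S) (<ᵇ-sound (proj₁ minimal))) ⟩
      ∣ S - f ∣           ≤⟨ S-f-independent ⟩
      r (S - f)           ∎) (r-≤-∪⁅⁆ (S - f) f)
      where open ≤-Reasoning

  externallyActive-complete : ∀ C f → Contracting C → A ! f ≡ false → C ! f ≡ false
                            → ExternallyActive C f → externallyActive G A φ C f ≡ true
  externallyActive-complete C f cC af cf active with minimal-below isCycleP T (<ᵇ-complete T-dependent)
    where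
    T = upper C f ∪ ⁅ f ⁆
    T-dependent : r T < ∣ T ∣
    T-dependent = subst (r T <_) (sym (∣∪⁅⁆∣ (upper C f) f (upper∌ C f))) (s≤s (≤-trans (≤-reflexive active) (r≤∣∣ (upper C f))))
  ... | S , S⊆T , minimal = any⇐ (λ S → isCycle G S ∧ S ! f ∧ smallestIn G φ f S) (subsetsOf (C ∪ ⁅ f ⁆))
                              (subsetsOf⇐ (C ∪ ⁅ f ⁆) S (sub S⊆C∪f)) (∧-intro minimal (∧-intro f∈S (smallestIn-complete f S af smallest)))
    where
    in-T : ∀ i → S ! i ≡ true → upper C f ! i ≡ true ⊎ f ≡ i
    in-T i s = ∪⁅⁆-elim (upper C f) f i (app S⊆T i s)
    S⊆C∪f : ∀ i → S ! i ≡ true → (C ∪ ⁅ f ⁆) ! i ≡ true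
    S⊆C∪f i s with in-T i s
    ... | inj₁ p    = ∪l C ⁅ f ⁆ (app (upper⊆ C f) i p)
    ... | inj₂ refl = ∪⁅⁆-new C f
    -- Otherwise the circuit S would lie inside the independent set C.
    f∈S : S ! f ≡ true
    f∈S = ≢false⇒≡true λ f∉S → <-irrefl (independent-⊆ {S = S} (Contracting.independent cC) (sub λ i s → S⊆C i s f∉S))
                                          (<ᵇ-sound (proj₁ (minimalᵇ⇒ isCycleP S minimal)))
      where
      S⊆C : ∀ i → S ! i ≡ true → S ! f ≡ false → C ! i ≡ true
      S⊆C i s f∉S with in-T i s
      ... | inj₁ p    = app (upper⊆ C f) i p
      ... | inj₂ refl = ⊥-elim (true≢false (trans (sym s) f∉S))
    smallest : ∀ g → S ! g ≡ true → A ! g ≡ false × label f ≤ label g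
    smallest g s with in-T g s
    ... | inj₁ p    = let a , lt = above-elim (proj₂ (∩e C (above f) p)) in a , <⇒≤ lt
    ... | inj₂ refl = af , ≤-refl

  module Exponents (X C : Subset m) (cC : Contracting C) (ok : ∀ e → Compatible X C e) where
    open Contracting cC
    open RankIdentities X C cC ok using (rank-X; rank-X∪A)

    exponent-x : rankM G ∸ r (X ∪ A) ≡ ∣ C ─ X ∣
    exponent-x = trans (cong (_∸ r (X ∪ A)) (sym rank-X∪A)) (m+n∸m≡n (r (X ∪ A)) ∣ C ─ X ∣)

    exponent-y : ∣ X ∣ ∸ r X ≡ ∣ X ─ C ∣
    exponent-y = trans (cong₂ _∸_ (∣∣-partition X C) (trans rank-X (cong ∣_∣ (∩-comm C X))))
                       (m+n∸m≡n ∣ X ∩ C ∣ ∣ X ─ C ∣)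

    r-X∪A∸r-X : r (X ∪ A) ∸ r X ≡ r Ground ∸ ∣ C ∣
    r-X∪A∸r-X = sym (begin
      r Ground ∸ ∣ C ∣                               ≡⟨ cong₂ _∸_ (sym rank-X∪A) (trans (∣∣-partition C X) (cong (_+ ∣ C ─ X ∣) (sym rank-X))) ⟩
      (r (X ∪ A) + ∣ C ─ X ∣) ∸ (r X + ∣ C ─ X ∣)     ≡⟨ cancel-∣C─X∣ ⟩
      r (X ∪ A) ∸ r X                               ∎)
      where
      open ≡-Reasoning
      cancel-∣C─X∣ : (r (X ∪ A) + ∣ C ─ X ∣) ∸ (r X + ∣ C ─ X ∣) ≡ r (X ∪ A) ∸ r X
      cancel-∣C─X∣ = trans (cong₂ _∸_ (+-comm (r (X ∪ A)) _) (+-comm (r X) _)) ([m+n]∸[m+o]≡n∸o ∣ C ─ X ∣ (r (X ∪ A)) (r X))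

    -- H_C has k(C) vertices and k(C ∪ A) components; as C is independent and C ∪ A spans, r(H_C) = r(E) − ∣ C ∣.
    rankContracted≡ : rankContracted G A C ≡ r Ground ∸ ∣ C ∣
    rankContracted≡ = begin
      components G C ∸ components G (C ∪ A)         ≡⟨ cong₂ _∸_ (trans (components≡n∸rank C) (cong (n ∸_) independent))
                                                               (trans (components≡n∸rank (C ∪ A)) (cong (n ∸_) spanning)) ⟩
      (n ∸ ∣ C ∣) ∸ (n ∸ r Ground)                  ≡⟨ ∸-∸-cancel ∣C∣≤r-Ground (rank≤n Ground) ⟩
      r Ground ∸ ∣ C ∣                              ∎
      where
      open ≡-Reasoning
      ∣C∣≤r-Ground : ∣ C ∣ ≤ r Ground
      ∣C∣≤r-Ground = ≤-trans (≤-reflexive (sym independent)) (subst (r C ≤_) spanning (r-mono (⊆∪l C A)))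
      ∸-∸-cancel : ∀ {p q k} → p ≤ q → q ≤ k → (k ∸ p) ∸ (k ∸ q) ≡ q ∸ p
      ∸-∸-cancel {p} {q} {k} p≤q q≤k = trans (cong (λ t → (t ∸ p) ∸ (k ∸ q)) (sym (m+[n∸m]≡n q≤k)))
                                         (trans (cong (_∸ (k ∸ q)) (+-∸-comm (k ∸ q) p≤q)) (m+n∸n≡m (q ∸ p) (k ∸ q)))

    exponent-z : r (X ∪ A) ∸ r X ≡ rankContracted G A C
    exponent-z = trans r-X∪A∸r-X (sym rankContracted≡)

module FiniteSums {c ℓ : Level} (R : CommutativeRing c ℓ) where
  open import Defs using (filterᵇ; allSubsets; sumL; prodL; pow)
  open import Data.Bool using (Bool; true; false; if_then_else_)
  open import Data.Nat using (zero; suc)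
  open import Data.Fin using (Fin; zero; suc)
  open import Data.Fin.Subset using (Subset; ∣_∣)
  open import Data.Vec using ([]; _∷_; tabulate; toList)
  open import Data.List using (List; []; _∷_; _++_; map)
  open import Data.List.Properties using (map-∘)
  import Relation.Binary.PropositionalEquality as ≡
  open ≡ using (_≡_; _≢_)

  open CommutativeRing R hiding (zero)
  open import Relation.Binary.Reasoning.Setoid setoid

  Σ[_] : ∀ {a} {A : Set a} → List A → (A → Carrier) → Carrier
  Σ[ xs ] f = sumL R (map f xs)

  Π : ∀ {k} → (Fin k → Carrier) → Carrier
  Π F = prodL R (toList (tabulate F))

  map-tabulate : ∀ {a b} {A : Set a} {B : Set b} {k} (f : A → B) (g : Fin k → A)
               → map f (toList (tabulate g)) ≡ toList (tabulate (λ i → f (g i)))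
  map-tabulate {k = zero}  f g = ≡.refl
  map-tabulate {k = suc k} f g = ≡.cong (f (g zero) ∷_) (map-tabulate f (λ i → g (suc i)))

  Σ-cong : ∀ {a} {A : Set a} xs {f g : A → Carrier} → (∀ x → f x ≈ g x) → Σ[ xs ] f ≈ Σ[ xs ] g
  Σ-cong []       h = refl
  Σ-cong (x ∷ xs) h = +-cong (h x) (Σ-cong xs h)

  Σ-zero : ∀ {a} {A : Set a} xs {f : A → Carrier} → (∀ x → f x ≈ 0#) → Σ[ xs ] f ≈ 0#
  Σ-zero []       h = refl
  Σ-zero (x ∷ xs) h = trans (+-cong (h x) (Σ-zero xs h)) (+-identityʳ 0#)

  Σ-++ : ∀ {a} {A : Set a} xs ys (f : A → Carrier) → Σ[ xs ++ ys ] f ≈ Σ[ xs ] f + Σ[ ys ] f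
  Σ-++ []       ys f = sym (+-identityˡ _)
  Σ-++ (x ∷ xs) ys f = trans (+-congˡ (Σ-++ xs ys f)) (sym (+-assoc _ _ _))

  Σ-+ : ∀ {a} {A : Set a} xs (f g : A → Carrier) → Σ[ xs ] (λ x → f x + g x) ≈ Σ[ xs ] f + Σ[ xs ] g
  Σ-+ []       f g = sym (+-identityʳ 0#)
  Σ-+ (x ∷ xs) f g = begin
    (f x + g x) + Σ[ xs ] (λ x → f x + g x) ≈⟨ +-congˡ (Σ-+ xs f g) ⟩
    (f x + g x) + (Σ[ xs ] f + Σ[ xs ] g)   ≈⟨ +-assoc _ _ _ ⟩
    f x + (g x + (Σ[ xs ] f + Σ[ xs ] g))   ≈⟨ +-congˡ (sym (+-assoc _ _ _)) ⟩
    f x + ((g x + Σ[ xs ] f) + Σ[ xs ] g)   ≈⟨ +-congˡ (+-congʳ (+-comm _ _)) ⟩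
    f x + ((Σ[ xs ] f + g x) + Σ[ xs ] g)   ≈⟨ +-congˡ (+-assoc _ _ _) ⟩
    f x + (Σ[ xs ] f + (g x + Σ[ xs ] g))   ≈⟨ sym (+-assoc _ _ _) ⟩
    (f x + Σ[ xs ] f) + (g x + Σ[ xs ] g)   ∎

  Σ-*ˡ : ∀ {a} {A : Set a} xs k (f : A → Carrier) → Σ[ xs ] (λ x → k * f x) ≈ k * Σ[ xs ] f
  Σ-*ˡ []       k f = sym (zeroʳ k)
  Σ-*ˡ (x ∷ xs) k f = trans (+-congˡ (Σ-*ˡ xs k f)) (sym (distribˡ k _ _))

  Σ-*ʳ : ∀ {a} {A : Set a} xs k (f : A → Carrier) → Σ[ xs ] (λ x → f x * k) ≈ Σ[ xs ] f * k
  Σ-*ʳ []       k f = sym (zeroˡ k)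
  Σ-*ʳ (x ∷ xs) k f = trans (+-congˡ (Σ-*ʳ xs k f)) (sym (distribʳ k _ _))

  Σ-swap : ∀ {a b} {A : Set a} {B : Set b} xs ys (F : A → B → Carrier)
         → Σ[ xs ] (λ x → Σ[ ys ] (F x)) ≈ Σ[ ys ] (λ y → Σ[ xs ] (λ x → F x y))
  Σ-swap []       ys F = sym (Σ-zero ys λ _ → refl)
  Σ-swap (x ∷ xs) ys F = trans (+-congˡ (Σ-swap xs ys F)) (sym (Σ-+ ys (F x) λ y → Σ[ xs ] (λ x → F x y)))

  Σ-map : ∀ {a b} {A : Set a} {B : Set b} xs (g : A → B) (f : B → Carrier) → Σ[ map g xs ] f ≡ Σ[ xs ] (λ x → f (g x))
  Σ-map xs g f = ≡.cong (sumL R) (≡.sym (map-∘ xs))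

  Σ-filter : ∀ {a} {A : Set a} xs (p : A → Bool) (f : A → Carrier)
           → Σ[ filterᵇ p xs ] f ≈ Σ[ xs ] (λ x → if p x then f x else 0#)
  Σ-filter []       p f = refl
  Σ-filter (x ∷ xs) p f with p x
  ... | true  = +-congˡ (Σ-filter xs p f)
  ... | false = trans (Σ-filter xs p f) (sym (+-identityˡ _))

  Σ-allSubsets-cons : ∀ k (g : Subset (suc k) → Carrier)
    → Σ[ allSubsets (suc k) ] g ≈ Σ[ allSubsets k ] (λ C → g (false ∷ C)) + Σ[ allSubsets k ] (λ C → g (true ∷ C))
  Σ-allSubsets-cons k g = begin
    Σ[ map (false ∷_) L ++ map (true ∷_) L ] g     ≈⟨ Σ-++ (map (false ∷_) L) (map (true ∷_) L) g ⟩
    Σ[ map (false ∷_) L ] g + Σ[ map (true ∷_) L ] g ≡⟨ ≡.cong₂ _+_ (Σ-map L (false ∷_) g) (Σ-map L (true ∷_) g) ⟩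
    Σ[ L ] (λ C → g (false ∷ C)) + Σ[ L ] (λ C → g (true ∷ C)) ∎
    where L = allSubsets k

  Σ-allSubsets-single : ∀ k (g : Subset k → Carrier) C₀ → (∀ C → C ≢ C₀ → g C ≈ 0#) → Σ[ allSubsets k ] g ≈ g C₀
  Σ-allSubsets-single zero    g []       h = +-identityʳ _
  Σ-allSubsets-single (suc k) g (b ∷ C₀) h = trans (Σ-allSubsets-cons k g) (by-head b h)
    where
    L = allSubsets k
    tail-≢ : ∀ {x} {C} → C ≢ C₀ → x ∷ C ≢ x ∷ C₀
    tail-≢ ne ≡.refl = ne ≡.refl
    by-head : ∀ b′ → (∀ C → C ≢ b′ ∷ C₀ → g C ≈ 0#)
            → Σ[ L ] (λ C → g (false ∷ C)) + Σ[ L ] (λ C → g (true ∷ C)) ≈ g (b′ ∷ C₀)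
    by-head false h′ = trans (+-cong (Σ-allSubsets-single k (λ C → g (false ∷ C)) C₀ λ C ne → h′ _ (tail-≢ ne))
                                     (Σ-zero L λ C → h′ (true ∷ C) λ ()))
                             (+-identityʳ _)
    by-head true  h′ = trans (+-cong (Σ-zero L λ C → h′ (false ∷ C) λ ())
                                     (Σ-allSubsets-single k (λ C → g (true ∷ C)) C₀ λ C ne → h′ _ (tail-≢ ne)))
                             (+-identityˡ _)

  Π-cong : ∀ {k} {F H : Fin k → Carrier} → (∀ i → F i ≈ H i) → Π F ≈ Π H
  Π-cong {zero}  h = refl
  Π-cong {suc k} h = *-cong (h zero) (Π-cong λ i → h (suc i))

  Π-zero : ∀ {k} (F : Fin k → Carrier) i → F i ≈ 0# → Π F ≈ 0#
  Π-zero F zero    h = trans (*-congʳ h) (zeroˡ _)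
  Π-zero F (suc i) h = trans (*-congˡ (Π-zero (λ j → F (suc j)) i h)) (zeroʳ _)

  Π-* : ∀ {k} (F H : Fin k → Carrier) → Π (λ i → F i * H i) ≈ Π F * Π H
  Π-* {zero}  F H = sym (*-identityʳ 1#)
  Π-* {suc k} F H = begin
    (F zero * H zero) * Π (λ i → F (suc i) * H (suc i)) ≈⟨ *-congˡ (Π-* (λ i → F (suc i)) (λ i → H (suc i))) ⟩
    (F zero * H zero) * (PF * PH)                       ≈⟨ *-assoc _ _ _ ⟩
    F zero * (H zero * (PF * PH))                       ≈⟨ *-congˡ (sym (*-assoc _ _ _)) ⟩
    F zero * ((H zero * PF) * PH)                       ≈⟨ *-congˡ (*-congʳ (*-comm _ _)) ⟩
    F zero * ((PF * H zero) * PH)                       ≈⟨ *-congˡ (*-assoc _ _ _) ⟩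
    F zero * (PF * (H zero * PH))                       ≈⟨ sym (*-assoc _ _ _) ⟩
    (F zero * PF) * (H zero * PH)                       ∎
    where
    PF = Π (λ i → F (suc i))
    PH = Π (λ i → H (suc i))

  Π-indicator : ∀ {k} (S : Subset k) u → Π (λ e → if S ! e then u else 1#) ≈ pow R u ∣ S ∣
  Π-indicator []          u = refl
  Π-indicator (true  ∷ S) u = *-congˡ (Π-indicator S u)
  Π-indicator (false ∷ S) u = trans (*-identityˡ _) (Π-indicator S u)

  Π-+-expand : ∀ k (h : Fin k → Bool → Carrier)
             → Π (λ e → h e false + h e true) ≈ Σ[ allSubsets k ] (λ X → Π (λ e → h e (X ! e)))
  Π-+-expand zero    h = sym (+-identityʳ _)
  Π-+-expand (suc k) h = begin
    (h zero false + h zero true) * Π (λ e → h (suc e) false + h (suc e) true) ≈⟨ *-congˡ (Π-+-expand k (λ e → h (suc e))) ⟩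
    (h zero false + h zero true) * Σ[ L ] rest                              ≈⟨ distribʳ _ _ _ ⟩
    h zero false * Σ[ L ] rest + h zero true * Σ[ L ] rest                  ≈⟨ +-cong (sym (Σ-*ˡ L (h zero false) rest)) (sym (Σ-*ˡ L (h zero true) rest)) ⟩
    Σ[ L ] (λ X → h zero false * rest X) + Σ[ L ] (λ X → h zero true * rest X) ≈⟨ sym (Σ-allSubsets-cons k (λ X → Π (λ e → h e (X ! e)))) ⟩
    Σ[ allSubsets (suc k) ] (λ X → Π (λ e → h e (X ! e)))                    ∎
    where
    L = allSubsets k
    rest : Subset k → Carrier
    rest X = Π (λ e → h (suc e) (X ! e))

module Expansion (G : Graph) (A : Subset (Graph.m G)) (φ : Fin (Graph.m G) → ℤ) (proper : ProperLabeling G A φ)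
                 {c ℓ : Level} (R : CommutativeRing c ℓ) (x y z : CommutativeRing.Carrier R) where
  open import Defs
    using (Graph; ProperLabeling; relTutte; tPoly; internallyActive; externallyActive; isContracting; rankContracted; rankM; rank;
           filterᵇ; allSubsets; subsetᵇ; subsetsOf; prodL; pow)
  open import Data.Bool using (Bool; true; false; _∧_; _∨_; not; if_then_else_)
  open import Data.Nat using (_∸_)
  open import Data.Fin using (Fin)
  open import Data.Fin.Subset using (Subset; _∪_; ∁; _─_; ∣_∣)
  open import Data.Integer using (ℤ)
  open import Data.Vec using (toList; allFin)
  open import Data.List using (map)
  open import Data.Product using (_,_; proj₁; proj₂)
  open import Data.Sum using (inj₁; inj₂)
  open import Data.Empty using (⊥-elim)
  import Relation.Binary.PropositionalEquality as ≡
  open ≡ using (_≡_; _≢_)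

  open Graph G using (m)
  open CommutativeRing R hiding (zero)
  open FiniteSums R
  open LabelledGraph G A φ proper
  open import Relation.Binary.Reasoning.Setoid setoid

  IA EA : Subset m → Fin m → Bool
  IA C e = internallyActive G A φ C e
  EA C e = externallyActive G A φ C e

  weight : Bool → Bool → Bool → Bool → Carrier
  weight a c ia ea = if a then 1# else (if c then (if ia then x else 1#) else (if ea then y else 1#))

  term : Subset m → Carrier
  term C = prodL R (map (λ e → weight (A ! e) (C ! e) (IA C e) (EA C e)) (toList (allFin m))) * pow R z (rankContracted G A C)

  tTerm : Subset m → Carrier
  tTerm X = pow R (x - 1#) (rankM G ∸ rank G (X ∪ A)) * pow R (y - 1#) (∣ X ∣ ∸ rank G X) * pow R z (rank G (X ∪ A) ∸ rank G X)

  u v : Carrier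
  u = x - 1#
  v = y - 1#

  -- Writing x = u + 1 and y = 1 + v, the weight of an edge splits according to whether it lies in X;
  -- `split a c ia ea b` is the part for e ∈ X ⇔ b, where a, c say whether e ∈ A, e ∈ C.
  split : Bool → Bool → Bool → Bool → Bool → Carrier
  split true  c     ia ea b     = if b then 0# else 1#
  split false true  ia ea true  = 1#
  split false true  ia ea false = if ia then u else 0#
  split false false ia ea true  = if ea then v else 0#
  split false false ia ea false = 1#

  allowed : Bool → Bool → Bool → Bool → Bool → Bool
  allowed true  c     ia ea b = not b
  allowed false true  ia ea b = ia ∨ b
  allowed false false ia ea b = ea ∨ not b

  factor : Bool → Bool → Carrier
  factor c b = (if c ∧ not b then u else 1#) * (if b ∧ not c then v else 1#)

  u+1≈x : u + 1# ≈ x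
  u+1≈x = trans (+-assoc x (- 1#) 1#) (trans (+-congˡ (-‿inverseˡ 1#)) (+-identityʳ x))

  1+v≈y : 1# + v ≈ y
  1+v≈y = trans (+-comm 1# v) (trans (+-assoc y (- 1#) 1#) (trans (+-congˡ (-‿inverseˡ 1#)) (+-identityʳ y)))

  weight-split : ∀ a c ia ea → weight a c ia ea ≈ split a c ia ea false + split a c ia ea true
  weight-split true  c     ia    ea    = sym (+-identityʳ 1#)
  weight-split false true  true  ea    = sym u+1≈x
  weight-split false true  false ea    = sym (+-identityˡ 1#)
  weight-split false false ia    true  = sym 1+v≈y
  weight-split false false ia    false = sym (+-identityʳ 1#)

  split-disallowed : ∀ a c ia ea b → allowed a c ia ea b ≡ false → split a c ia ea b ≈ 0#
  split-disallowed true  c     ia    ea    true  _ = refl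
  split-disallowed false true  false ea    false _ = refl
  split-disallowed false false ia    false true  _ = refl
  split-disallowed true  c     ia    ea    false ()
  split-disallowed false true  true  ea    b     ()
  split-disallowed false true  false ea    true  ()
  split-disallowed false false ia    true  b     ()
  split-disallowed false false ia    false false ()

  split-allowed : ∀ a c ia ea b → allowed a c ia ea b ≡ true → (a ≡ true → c ≡ false) → split a c ia ea b ≈ factor c b
  split-allowed true  c     ia    ea    true  () _
  split-allowed true  c     ia    ea    false _  h with h ≡.refl
  ... | ≡.refl = sym (*-identityˡ 1#)
  split-allowed false true  ia    ea    true  _  _ = sym (*-identityˡ 1#)
  split-allowed false true  true  ea    false _  _ = sym (*-identityʳ u)
  split-allowed false true  false ea    false () _
  split-allowed false false ia    true  true  _  _ = sym (*-identityˡ v)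
  split-allowed false false ia    false true  () _
  split-allowed false false ia    ea    false _  _ = sym (*-identityˡ 1#)

  splitAt : Subset m → Fin m → Bool → Carrier
  splitAt C e = split (A ! e) (C ! e) (IA C e) (EA C e)

  allowedAt : Subset m → Subset m → Fin m → Bool
  allowedAt C X e = allowed (A ! e) (C ! e) (IA C e) (EA C e) (X ! e)

  expanded : Subset m → Subset m → Carrier
  expanded C X = Π (λ e → splitAt C e (X ! e)) * pow R z (rankContracted G A C)

  term-expand : ∀ C → term C ≈ Σ[ allSubsets m ] (expanded C)
  term-expand C = begin
    term C                                                                ≡⟨ ≡.cong (λ l → prodL R l * pz) (map-tabulate (λ e → weight (A ! e) (C ! e) (IA C e) (EA C e)) (λ i → i)) ⟩
    Π (λ e → weight (A ! e) (C ! e) (IA C e) (EA C e)) * pz               ≈⟨ *-congʳ (Π-cong λ e → weight-split (A ! e) (C ! e) (IA C e) (EA C e)) ⟩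
    Π (λ e → splitAt C e false + splitAt C e true) * pz                   ≈⟨ *-congʳ (Π-+-expand m (splitAt C)) ⟩
    Σ[ allSubsets m ] (λ X → Π (λ e → splitAt C e (X ! e))) * pz          ≈⟨ sym (Σ-*ʳ (allSubsets m) pz _) ⟩
    Σ[ allSubsets m ] (expanded C)                                        ∎
    where pz = pow R z (rankContracted G A C)

  expanded-disallowed : ∀ C X e → allowedAt C X e ≡ false → expanded C X ≈ 0#
  expanded-disallowed C X e h = trans (*-congʳ (Π-zero (λ e → splitAt C e (X ! e)) e
    (split-disallowed (A ! e) (C ! e) (IA C e) (EA C e) (X ! e) h))) (zeroˡ _)

  allowedAt-≡ : ∀ C X e {a c} → A ! e ≡ a → C ! e ≡ c → allowedAt C X e ≡ allowed a c (IA C e) (EA C e) (X ! e)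
  allowedAt-≡ C X e ≡.refl ≡.refl = ≡.refl

  allowed⇒compatible : ∀ X C → Contracting C → (∀ e → allowedAt C X e ≡ true) → ∀ e → Compatible X C e
  allowed⇒compatible X C cC h e = record
    { zero-edge = λ ae → not-elim (at ae ≡.refl)
    ; internal  = λ ce xe → internallyActive-sound C e cC ce (left-of-∨ (at (∉A (Contracting.⊆∁A cC) ce) ce) xe)
    ; external  = λ ae ce xe → externallyActive-sound C e cC ae ce (left-of-∨ (at ae ce) (≡.cong not xe))
    }
    where
    at : ∀ {a c} → A ! e ≡ a → C ! e ≡ c → allowed a c (IA C e) (EA C e) (X ! e) ≡ true
    at ae ce = ≡.trans (≡.sym (allowedAt-≡ C X e ae ce)) (h e)
    left-of-∨ : ∀ {p q} → p ∨ q ≡ true → q ≡ false → p ≡ true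
    left-of-∨ {true}  _ _ = ≡.refl
    left-of-∨ {false} h ≡.refl = h

  compatible⇒allowed : ∀ X C → Contracting C → (∀ e → Compatible X C e) → ∀ e → allowedAt C X e ≡ true
  compatible⇒allowed X C cC ok e with true⊎false (A ! e) | true⊎false (C ! e) | true⊎false (X ! e)
  ... | inj₁ ae | _       | _       = ≡.trans (allowedAt-≡ C X e ae ≡.refl) (not-intro (Compatible.zero-edge (ok e) ae))
  ... | inj₂ ae | inj₁ ce | inj₁ xe = ≡.trans (allowedAt-≡ C X e ae ce) (∨-introʳ {IA C e} xe)
  ... | inj₂ ae | inj₁ ce | inj₂ xe = ≡.trans (allowedAt-≡ C X e ae ce)
                                        (∨-introˡ (internallyActive-complete C e cC ce (Compatible.internal (ok e) ce xe)))
  ... | inj₂ ae | inj₂ ce | inj₁ xe = ≡.trans (allowedAt-≡ C X e ae ce)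
                                        (∨-introˡ (externallyActive-complete C e cC ae ce (Compatible.external (ok e) ae ce xe)))
  ... | inj₂ ae | inj₂ ce | inj₂ xe = ≡.trans (allowedAt-≡ C X e ae ce) (∨-introʳ {EA C e} (not-intro xe))

  expanded-compatible : ∀ X C → Contracting C → (∀ e → Compatible X C e) → expanded C X ≈ tTerm X
  expanded-compatible X C cC ok = begin
    expanded C X
      ≈⟨ *-congʳ (Π-cong λ e → split-allowed (A ! e) (C ! e) (IA C e) (EA C e) (X ! e)
                                 (compatible⇒allowed X C cC ok e) (∉C (Contracting.⊆∁A cC))) ⟩
    Π (λ e → factor (C ! e) (X ! e)) * pz
      ≈⟨ *-congʳ (Π-* (λ e → if C ! e ∧ not (X ! e) then u else 1#) (λ e → if X ! e ∧ not (C ! e) then v else 1#)) ⟩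
    Π (λ e → if C ! e ∧ not (X ! e) then u else 1#) * Π (λ e → if X ! e ∧ not (C ! e) then v else 1#) * pz
      ≈⟨ *-congʳ (*-cong (Π-cong λ e → reflexive (≡.cong (λ b → if b then u else 1#) (≡.sym (!─ C X e))))
                         (Π-cong λ e → reflexive (≡.cong (λ b → if b then v else 1#) (≡.sym (!─ X C e))))) ⟩
    Π (λ e → if (C ─ X) ! e then u else 1#) * Π (λ e → if (X ─ C) ! e then v else 1#) * pz
      ≈⟨ *-congʳ (*-cong (Π-indicator (C ─ X) u) (Π-indicator (X ─ C) v)) ⟩
    pow R u ∣ C ─ X ∣ * pow R v ∣ X ─ C ∣ * pz
      ≡⟨ ≡.sym (≡.cong₂ _*_ (≡.cong₂ (λ i j → pow R u i * pow R v j) exponent-x exponent-y) (≡.cong (pow R z) exponent-z)) ⟩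
    tTerm X ∎
    where
    open Exponents X C cC ok
    pz = pow R z (rankContracted G A C)

  contribution : Subset m → Subset m → Carrier
  contribution C X = if isContracting G A C then expanded C X else 0#

  contracting-term-expand : ∀ C → (if isContracting G A C then term C else 0#)
                                  ≈ Σ[ allSubsets m ] (λ X → if isContracting G A C then expanded C X else 0#)
  contracting-term-expand C with isContracting G A C
  ... | true  = term-expand C
  ... | false = sym (Σ-zero (allSubsets m) λ _ → refl)

  -- Only the unique contracting set compatible with X contributes, and none does unless X ⊆ E ─ A.
  Σ-contributions : ∀ X → Σ[ allSubsets m ] (λ C → contribution C X) ≈ (if subsetᵇ X (∁ A) then tTerm X else 0#)
  Σ-contributions X with true⊎false (subsetᵇ X (∁ A))
  ... | inj₁ X⊆ rewrite X⊆ = Σ-from-X⊆ (subsetᵇ⇒ X (∁ A) X⊆)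
    where
    Σ-from-X⊆ : X ⊆ ∁ A → Σ[ allSubsets m ] (λ C → contribution C X) ≈ tTerm X
    Σ-from-X⊆ X⊆∁A with Construction.compatible-exists X X⊆∁A
    ... | C₀ , cC₀ , ok₀ = begin
      Σ[ allSubsets m ] (λ C → contribution C X) ≈⟨ Σ-allSubsets-single m (λ C → contribution C X) C₀ others ⟩
      contribution C₀ X                          ≡⟨ ≡.cong (λ b → if b then expanded C₀ X else 0#) (contracting-complete C₀ cC₀) ⟩
      expanded C₀ X                              ≈⟨ expanded-compatible X C₀ cC₀ ok₀ ⟩
      tTerm X                                    ∎
      where
      others : ∀ C → C ≢ C₀ → contribution C X ≈ 0#
      others C ne with true⊎false (isContracting G A C)
      ... | inj₂ f rewrite f = refl
      ... | inj₁ t rewrite t with true⊎false (Defs.all (allowedAt C X) (toList (allFin m)))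
      ...   | inj₁ all-allowed = ⊥-elim (ne (compatible-unique X C C₀ (contracting-sound C t) cC₀
                                   (allowed⇒compatible X C (contracting-sound C t) (allFin⇒ (allowedAt C X) all-allowed)) ok₀))
      ...   | inj₂ some-not = let e , q = allFin≡false (allowedAt C X) some-not in expanded-disallowed C X e q
  ... | inj₂ X⊈ rewrite X⊈ = Σ-zero (allSubsets m) λ C → contribution≈0 C
    where
    bad = allFin≡false (λ i → not (X ! i) ∨ ∁ A ! i) X⊈
    e = proj₁ bad
    xe : X ! e ≡ true
    xe = ≢false⇒≡true λ q → true≢false (≡.trans (≡.sym (∨-introˡ {b = ∁ A ! e} (not-intro q))) (proj₂ bad))
    ae : A ! e ≡ true
    ae = ≢false⇒≡true λ q → true≢false (≡.trans (≡.sym (∨-introʳ {not (X ! e)} (∁i A q))) (proj₂ bad))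
    contribution≈0 : ∀ C → contribution C X ≈ 0#
    contribution≈0 C with isContracting G A C
    ... | false = refl
    ... | true  = expanded-disallowed C X e (≡.trans (allowedAt-≡ C X e ae ≡.refl) (≡.cong not xe))

lemma4p6 : (G : Graph) (A : Subset (Graph.m G)) (φ : Fin (Graph.m G) → ℤ)
           → ProperLabeling G A φ
           → ∀ {c ℓ} (R : CommutativeRing c ℓ) (x y z : CommutativeRing.Carrier R)
           → CommutativeRing._≈_ R
               (relTutte R G A φ x (CommutativeRing.1# R) y (CommutativeRing.1# R) z)
               (tPoly R G A x y z)
lemma4p6 G A φ proper R x y z = begin
  relTutte R G A φ x 1# y 1# z                                              ≡⟨⟩
  Σ[ filterᵇ (isContracting G A) 𝒫E ] term                                  ≈⟨ Σ-filter 𝒫E (isContracting G A) term ⟩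
  Σ[ 𝒫E ] (λ C → if isContracting G A C then term C else 0#)              ≈⟨ Σ-cong 𝒫E contracting-term-expand ⟩
  Σ[ 𝒫E ] (λ C → Σ[ 𝒫E ] (contribution C))                                ≈⟨ Σ-swap 𝒫E 𝒫E contribution ⟩
  Σ[ 𝒫E ] (λ X → Σ[ 𝒫E ] (λ C → contribution C X))                        ≈⟨ Σ-cong 𝒫E Σ-contributions ⟩
  Σ[ 𝒫E ] (λ X → if subsetᵇ X (∁ A) then tTerm X else 0#)                  ≈⟨ sym (Σ-filter 𝒫E (λ X → subsetᵇ X (∁ A)) tTerm) ⟩
  Σ[ subsetsOf (∁ A) ] tTerm                                                ≡⟨⟩
  tPoly R G A x y z                                                         ∎
  where
  open CommutativeRing R
  open FiniteSums R
  open Expansion G A φ proper R x y z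
  open import Relation.Binary.Reasoning.Setoid setoid
  𝒫E = allSubsets (Graph.m G)
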